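{- Let $N\ge 2$ be an integer. Then $N$ is monomially irreducible if and only if $N$ is a prime number or $N\in\{4,6,8,12,24\}$.
   Context: For an integer $N\ge 2$ and $a_1,\dots,a_n\in\mathbb{Z}/N\mathbb{Z}$, set $M_n(a_1,\dots,a_n)=\begin{pmatrix}a_n&-1\\1&0\end{pmatrix}\begin{pmatrix}a_{n-1}&-1\\1&0\end{pmatrix}\cdots\begin{pmatrix}a_1&-1\\1&0\end{pmatrix}\in SL_2(\mathbb{Z}/N\mathbb{Z})$. The equation $(E_N)$ is $M_n(a_1,\dots,a_n)=\pm \mathrm{Id}$; an $n$-tuple satisfying it is a solution of size $n$. For tuples define $(a_1,\dots,a_n)\oplus(b_1,\dots,b_m)=(a_1+b_m,a_2,\dots,a_{n-1},a_n+b_1,b_2,\dots,b_{m-1})$, and write $(a_1,\dots,a_n)\sim(b_1,\dots,b_n)$ if $(b_1,\dots,b_n)$ is obtained by a cyclic permutation of $(a_1,\dots,a_n)$ or of $(a_n,\dots,a_1)$. A solution $(c_1,\dots,c_n)$ of $(E_N)$ with $n\ge 3$ is reducible if there exist a solution $(b_1,\dots,b_l)$ of $(E_N)$ and an $m$-tuple $(a_1,\dots,a_m)$ of elements of $\mathbb{Z}/N\mathbb{Z}$ with $m\ge3$, $l\ge 3$ and $(c_1,\dots,c_n)\sim(a_1,\dots,a_m)\oplus(b_1,\dots,b_l)$; otherwise it is irreducible ($(\overline0,\overline0)$ is not considered irreducible). For $\overline k\in\mathbb{Z}/N\mathbb{Z}$, the $\overline k$-monomial minimal solution of $(E_N)$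 is the $n$-tuple $(\overline k,\dots,\overline k)$ where $n$ is the least positive integer such that this $n$-tuple is a solution of $(E_N)$ (it always exists). $N$ is called monomially irreducible if for every $\overline k\neq\overline 0$ the $\overline k$-monomial minimal solution of $(E_N)$ is irreducible. -}

module Defs where

open import Data.Nat using (ℕ; zero; suc; _+_; _*_; _∸_; _≤_; _<_; NonZero)
open import Data.Nat.DivMod using (_mod_)
open import Data.Fin using (Fin; toℕ)
open import Data.List using (List; []; _∷_; _++_; length; replicate; reverse; take; drop)
open import Data.Maybe using (Maybe; just; nothing)
open import Data.Product using (_×_; _,_; ∃; ∃-syntax)
open import Data.Sum using (_⊎_)
open import Relation.Binary.PropositionalEquality using (_≡_)
open import Relation.Nullary using (¬_)

-- Z/NZ is represented by Fin N (canonical representatives 0..N-1).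
module _ (N : ℕ) .{{_ : NonZero N}} where

  ZN : Set
  ZN = Fin N

  infixl 6 _⊞_
  infixl 7 _⊠_

  _⊞_ : ZN → ZN → ZN
  a ⊞ b = (toℕ a + toℕ b) mod N

  _⊠_ : ZN → ZN → ZN
  a ⊠ b = (toℕ a * toℕ b) mod N

  neg : ZN → ZN
  neg a = (N ∸ toℕ a) mod N

  zeroN oneN : ZN
  zeroN = 0 mod N
  oneN  = 1 mod N

  record Mat : Set where
    constructor mat
    field
      m11 m12 m21 m22 : ZN

  _·_ : Mat → Mat → Mat
  mat a b c d · mat e f g h =
    mat (a ⊠ e ⊞ b ⊠ g) (a ⊠ f ⊞ b ⊠ h) (c ⊠ e ⊞ d ⊠ g) (c ⊠ f ⊞ d ⊠ h)

  Id : Mat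
  Id = mat oneN zeroN zeroN oneN

  negId : Mat
  negId = mat (neg oneN) zeroN zeroN (neg oneN)

  Mk : ZN → Mat
  Mk a = mat a (neg oneN) oneN zeroN

  -- M_n(a_1,...,a_n) = Mk a_n ⋯ Mk a_1
  Mn : List ZN → Mat
  Mn []       = Id
  Mn (a ∷ as) = Mn as · Mk a

  Solution : List ZN → Set
  Solution as = Mn as ≡ Id ⊎ Mn as ≡ negId

  unsnoc : List ZN → Maybe (List ZN × ZN)
  unsnoc []       = nothing
  unsnoc (x ∷ xs) with unsnoc xs
  ... | nothing         = just ([] , x)
  ... | just (ys , y)   = just (x ∷ ys , y)

  -- (a_1,...,a_n) ⊕ (b_1,...,b_m)
  --   = (a_1 + b_m, a_2, ..., a_{n-1}, a_n + b_1, b_2, ..., b_{m-1}).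
  -- Only meaningful for n, m ≥ 2 (returns [] otherwise; only used with n, m ≥ 3).
  _⊕_ : List ZN → List ZN → List ZN
  (a₁ ∷ as) ⊕ (b₁ ∷ bs) with unsnoc as | unsnoc bs
  ... | just (amid , aₙ) | just (bmid , bₘ) = (a₁ ⊞ bₘ) ∷ amid ++ ((aₙ ⊞ b₁) ∷ bmid)
  ... | _ | _ = []
  _ ⊕ _ = []

  rotate : ℕ → List ZN → List ZN
  rotate k xs = drop k xs ++ take k xs

  _∼_ : List ZN → List ZN → Set
  xs ∼ ys = ∃[ k ] (ys ≡ rotate k xs ⊎ ys ≡ rotate k (reverse xs))

  Reducible : List ZN → Set
  Reducible c =
    3 ≤ length c ×
    ∃[ a ] ∃[ b ] (Solution b × 3 ≤ length a × 3 ≤ length b × c ∼ (a ⊕ b))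

  Irreducible : List ZN → Set
  Irreducible c = Solution c × 3 ≤ length c × ¬ Reducible c

  IsMonomialMinimalSize : ZN → ℕ → Set
  IsMonomialMinimalSize k n =
    1 ≤ n × Solution (replicate n k) ×
    (∀ m → 1 ≤ m → m < n → ¬ Solution (replicate m k))

  MonomiallyIrreducible : Set
  MonomiallyIrreducible =
    ∀ (k : ZN) → ¬ (k ≡ zeroN) → ∀ n → IsMonomialMinimalSize k n →
      Irreducible (replicate n k)

-- Fix a residue k ≢ 0 and let s₀ = 0, s₁ = 1, s_{j+2} = k s_{j+1} − s_j (Chebyshev polynomials of
-- the second kind at k/2).  Then M_j(k,…,k) = [[s_{j+1}, −s_j], [s_j, s_{j+1} − k s_j]], so (k,…,k)
-- of size j is a solution iff s_j ≡ 0 and s_{j+1} ≡ ±1.  The monomial minimal solution, of size n,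
-- is reducible iff some (b, k, …, k, b′) with L middle letters, 1 ≤ L ≤ n − 3, is a solution, that
-- is iff s_{L+1} ≡ ±1 (take b = b′ = s_{L+1} s_L).  For N prime, s_{L+1} ≡ ±1 and the determinant
-- identity give s_L (s_L − k s_{L+1}) ≡ 0, hence a shorter solution of size L or L + 2.
-- The moduli 4, 6, 8, 12, 24 are checked by computation.  Any other composite N has a factor d²
-- with d ≥ 3, where k = N/d is nilpotent and s₃ ≡ −1 comes before the first zero s_{2d}, or is
-- p B with p ≥ 5 prime, p ∤ B, B ≥ 2, where k ≡ 2 (mod p), k ≡ 1 (mod B) gives s_j ≡ j (mod p)
-- and s of period 6 (mod B), so ±1 occurs at p ± 1 before the first zero s_{3p}.
module Submission where

open import Data.Empty using (⊥-elim)
open import Data.Fin.Base using (Fin; toℕ; fromℕ<)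
open import Data.Fin.Properties using (toℕ-fromℕ<; toℕ-injective; toℕ<n; _≟_; all?; any?)
open import Data.Integer.Base as ℤ using (ℤ; +_; -[1+_]; _+_; _*_; -_; _-_; _^_; 0ℤ; 1ℤ; ∣_∣; _/ℕ_)
import Data.Integer.Coprimality as ℤ using (coprime-divisor)
open import Data.Integer.Divisibility.Signed using (∣ᵤ⇒∣; divides)
open import Data.Integer.DivMod using (n%ℕd<d; a≡a%ℕn+[a/ℕn]*n)
import Data.Integer.Properties as ℤ
open import Data.Integer.Tactic.RingSolver using (solve-∀)
open import Data.List.Base using (List; []; _∷_; _∷ʳ_; _++_; replicate; map; length; reverse; take; drop; initLast; _∷ʳ′_)
open import Data.List.Properties
  using (map-replicate; length-replicate; map-++; length-++; length-drop; length-take; unfold-reverse; ++-identityʳ)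
open import Data.List.Relation.Unary.All using (All; []; _∷_)
import Data.List.Relation.Unary.All.Properties as All
open import Data.Maybe.Base using (just)
open import Data.Nat.Base as ℕ using (ℕ; zero; suc; NonZero; _≤_; _<_; z≤n; s≤s)
open import Data.Nat.Coprimality as Coprimality using (Coprime; coprime-Bézout)
open import Data.Nat.DivMod using (_mod_; _%_; _/_; m≡m%n+[m/n]*n; m%n<n)
open import Data.Nat.Divisibility using (divides; _∣?_; ∣-trans; n∣m*n; m∣m*n; ∣⇒≤) renaming (_∣_ to _∣ℕ_)
open import Data.Nat.GCD using (module Bézout)
open import Data.Nat.Induction using (<-wellFounded)
open import Data.Nat.ListAction using (product)
open import Data.Nat.Primality using (Prime; prime?; euclidsLemma; prime⇒irreducible)
open import Data.Nat.Primality.Factorisation using (PrimeFactorisation; factorise; factors)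
import Data.Nat.Properties as ℕ
import Data.Nat.Tactic.RingSolver as ℕ-Solver
open import Data.Product.Algebra using (×-distribˡ-⊎)
open import Data.Product.Base using (∃-syntax; _×_; _,_; proj₁; proj₂)
open import Data.Sum.Base as Sum using (_⊎_; inj₁; inj₂; [_,_]′)
open import Data.Sum.Function.Propositional using (_⊎-⇔_)
open import Function.Base using (id; _∘_)
open import Function.Bundles using (_⇔_; mk⇔; Equivalence)
import Function.Properties.Equivalence as ⇔ using (sym; trans)
open import Function.Properties.Inverse using (↔⇒⇔)
open import Induction.WellFounded using (Acc; acc)
open import Relation.Binary.Bundles using (Setoid)
open import Relation.Binary.Definitions using (DecidableEquality)
open import Relation.Binary.PropositionalEquality
import Relation.Binary.Reasoning.Setoid as SetoidReasoning
open import Relation.Nullary.Decidable using (Dec; yes; no; map′; _×-dec_; _⊎-dec_; _→-dec_; ¬?; from-yes)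
import Relation.Nullary.Decidable as Dec using (map)
open import Relation.Nullary.Negation using (¬_)

open import Defs

-- Unlike ℕ.anyUpTo?, which matches on yes/no and so normalises the proofs as well, this is built
-- from lazy combinators: evaluating a from-yes over it only computes booleans.
any<? : ∀ {P : ℕ → Set} → (∀ n → Dec (P n)) → ∀ v → Dec (∃[ n ] n < v × P n)
any<? {P} P? v = Dec.map
  (mk⇔ (λ (i , Pi) → toℕ i , toℕ<n i , Pi)
       (λ (n , n<v , Pn) → fromℕ< n<v , subst P (sym (toℕ-fromℕ< n<v)) Pn))
  (any? (P? ∘ toℕ))

all<? : ∀ {P : ℕ → Set} → (∀ n → Dec (P n)) → ∀ v → Dec (∀ n → n < v → P n)
all<? {P} P? v = Dec.map
  (mk⇔ (λ ∀i n n<v → subst P (toℕ-fromℕ< n<v) (∀i (fromℕ< n<v)))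
       (λ ∀n i → ∀n (toℕ i) (toℕ<n i)))
  (all? (P? ∘ toℕ))

leastPositive : ∀ {P : ℕ → Set} → (∀ n → Dec (P n)) → ∀ {n} → 1 ≤ n → P n →
                ∃[ m ] 1 ≤ m × P m × (∀ j → 1 ≤ j → j < m → ¬ P j)
leastPositive {P} P? 1≤n Pn = search _ (<-wellFounded _) 1≤n Pn
  where
  search : ∀ n → Acc _<_ n → 1 ≤ n → P n → ∃[ m ] 1 ≤ m × P m × (∀ j → 1 ≤ j → j < m → ¬ P j)
  search n (acc smaller) 1≤n Pn with any<? (λ j → (1 ℕ.≤? j) ×-dec P? j) n
  ... | yes (j , j<n , 1≤j , Pj) = search j (smaller j<n) 1≤j Pj
  ... | no none = n , 1≤n , Pn , λ j 1≤j j<n Pj → none (j , j<n , 1≤j , Pj)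

module _ {A : Set} where

  reverse-replicate : ∀ n (x : A) → reverse (replicate n x) ≡ replicate n x
  reverse-replicate zero    x = refl
  reverse-replicate (suc n) x = begin
    reverse (x ∷ replicate n x)   ≡⟨ unfold-reverse x (replicate n x) ⟩
    reverse (replicate n x) ∷ʳ x  ≡⟨ cong (_∷ʳ x) (reverse-replicate n x) ⟩
    replicate n x ∷ʳ x            ≡⟨ replicate-∷ʳ n ⟩
    replicate (suc n) x           ∎
    where
    open ≡-Reasoning
    replicate-∷ʳ : ∀ n → replicate n x ∷ʳ x ≡ x ∷ replicate n x
    replicate-∷ʳ zero    = refl
    replicate-∷ʳ (suc n) = cong (x ∷_) (replicate-∷ʳ n)

  All≡⇒replicate : ∀ {x : A} xs → All (_≡ x) xs → xs ≡ replicate (length xs) x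
  All≡⇒replicate []       []           = refl
  All≡⇒replicate (_ ∷ xs) (refl ∷ xs≡) = cong (_ ∷_) (All≡⇒replicate xs xs≡)

  replicate-+ : ∀ m n (x : A) → replicate (m ℕ.+ n) x ≡ replicate m x ++ replicate n x
  replicate-+ zero    n x = refl
  replicate-+ (suc m) n x = cong (x ∷_) (replicate-+ m n x)

module Modulo (N : ℕ) where

  infix 4 _≈_
  record _≈_ (x y : ℤ) : Set where
    constructor congruent
    field
      quotient : ℤ
      equation : x ≡ y + quotient * + N

  private
    shift-zero : ∀ x n → x ≡ x + 0ℤ * n
    shift-zero = solve-∀
    shift-back : ∀ y q n → y ≡ (y + q * n) + (- q) * n
    shift-back = solve-∀
    shift-twice : ∀ z q r n → (z + r * n) + q * n ≡ z + (q + r) * n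
    shift-twice = solve-∀
    shift-+ : ∀ x y q r n → (x + q * n) + (y + r * n) ≡ (x + y) + (q + r) * n
    shift-+ = solve-∀
    shift-* : ∀ x y q r n → (x + q * n) * (y + r * n) ≡ x * y + (q * y + x * r + q * r * n) * n
    shift-* = solve-∀
    shift-neg : ∀ x q n → - (x + q * n) ≡ - x + (- q) * n
    shift-neg = solve-∀

  ≈-refl : ∀ {x} → x ≈ x
  ≈-refl {x} = congruent 0ℤ (shift-zero x (+ N))

  ≡⇒≈ : ∀ {x y} → x ≡ y → x ≈ y
  ≡⇒≈ refl = ≈-refl

  ≈-sym : ∀ {x y} → x ≈ y → y ≈ x
  ≈-sym {y = y} (congruent q refl) = congruent (- q) (shift-back y q (+ N))

  ≈-trans : ∀ {x y z} → x ≈ y → y ≈ z → x ≈ z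
  ≈-trans {z = z} (congruent q refl) (congruent r refl) = congruent (q + r) (shift-twice z q r (+ N))

  ≈-setoid : Setoid _ _
  ≈-setoid = record
    { Carrier = ℤ
    ; _≈_ = _≈_
    ; isEquivalence = record { refl = ≈-refl ; sym = ≈-sym ; trans = ≈-trans }
    }

  module ≈-Reasoning = SetoidReasoning ≈-setoid

  +-cong : ∀ {x x′ y y′} → x ≈ x′ → y ≈ y′ → x + y ≈ x′ + y′
  +-cong {x′ = x′} {y′ = y′} (congruent q refl) (congruent r refl) =
    congruent (q + r) (shift-+ x′ y′ q r (+ N))

  *-cong : ∀ {x x′ y y′} → x ≈ x′ → y ≈ y′ → x * y ≈ x′ * y′
  *-cong {x′ = x′} {y′ = y′} (congruent q refl) (congruent r refl) =
    congruent (q * y′ + x′ * r + q * r * + N) (shift-* x′ y′ q r (+ N))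

  -‿cong : ∀ {x x′} → x ≈ x′ → - x ≈ - x′
  -‿cong {x′ = x′} (congruent q refl) = congruent (- q) (shift-neg x′ q (+ N))

  x-y≈0⇒x≈y : ∀ {x y} → x - y ≈ 0ℤ → x ≈ y
  x-y≈0⇒x≈y {x} {y} x-y≈0 = begin
    x              ≡⟨ split x y ⟩
    (x - y) + y    ≈⟨ +-cong x-y≈0 (≈-refl {x = y}) ⟩
    0ℤ + y         ≡⟨ ℤ.+-identityˡ y ⟩
    y              ∎
    where
    open ≈-Reasoning
    split : ∀ x y → x ≡ (x - y) + y
    split = solve-∀

  *N≈0 : ∀ q → q * + N ≈ 0ℤ
  *N≈0 q = congruent q (sym (ℤ.+-identityˡ (q * + N)))

  N≈0 : + N ≈ 0ℤ
  N≈0 = ≈-trans (≡⇒≈ (sym (ℤ.*-identityˡ (+ N)))) (*N≈0 1ℤ)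

  ∣∣⇒≈0 : ∀ {x} → N ∣ℕ ∣ x ∣ → x ≈ 0ℤ
  ∣∣⇒≈0 {x = + _}      (divides m refl) = ≈-trans (≡⇒≈ (ℤ.pos-* m N)) (*N≈0 (+ m))
  ∣∣⇒≈0 {x = -[1+ _ ]} (divides m eq)   = begin
    -[1+ _ ]       ≡⟨ cong -_ (trans (cong +_ eq) (ℤ.pos-* m N)) ⟩
    - (+ m * + N)  ≡⟨ ℤ.neg-distribˡ-* (+ m) (+ N) ⟩
    - + m * + N    ≈⟨ *N≈0 (- + m) ⟩
    0ℤ             ∎
    where open ≈-Reasoning

  ≈0⇒∣∣ : ∀ {x} → x ≈ 0ℤ → N ∣ℕ ∣ x ∣
  ≈0⇒∣∣ (congruent q refl) =
    divides ∣ q ∣ (trans (cong ∣_∣ (ℤ.+-identityˡ (q * + N))) (ℤ.abs-* q (+ N)))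

  prime-*≈0 : Prime N → ∀ x y → x * y ≈ 0ℤ → x ≈ 0ℤ ⊎ y ≈ 0ℤ
  prime-*≈0 N-prime x y xy≈0
    with euclidsLemma ∣ x ∣ ∣ y ∣ N-prime (subst (N ∣ℕ_) (ℤ.abs-* x y) (≈0⇒∣∣ xy≈0))
  ... | inj₁ N∣x = inj₁ (∣∣⇒≈0 N∣x)
  ... | inj₂ N∣y = inj₂ (∣∣⇒≈0 N∣y)

  coprime⇒invertible : ∀ {b} → Coprime b N → ∃[ t ] + b * t ≈ 1ℤ
  coprime⇒invertible {b} b⊥N with coprime-Bézout b⊥N
  ... | Bézout.+- x y 1+yN≡xb = + x , congruent (+ y) (begin
    + b * + x          ≡⟨ ℤ.pos-* b x ⟨
    + (b ℕ.* x)        ≡⟨ cong +_ (trans (ℕ.*-comm b x) (sym 1+yN≡xb)) ⟩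
    + (1 ℕ.+ y ℕ.* N)  ≡⟨ cong (_+_ 1ℤ) (ℤ.pos-* y N) ⟩
    1ℤ + + y * + N     ∎)
    where open ≡-Reasoning
  ... | Bézout.-+ x y 1+xb≡yN = - + x , congruent (- + y) (begin
    + b * - + x                 ≡⟨ rearrange (+ b) (+ x) ⟩
    1ℤ - (1ℤ + + x * + b)       ≡⟨ cong (λ z → 1ℤ - z) (trans (cong (_+_ 1ℤ) (sym (ℤ.pos-* x b))) (cong +_ 1+xb≡yN)) ⟩
    1ℤ - + (y ℕ.* N)            ≡⟨ cong (λ z → 1ℤ - z) (ℤ.pos-* y N) ⟩
    1ℤ - + y * + N              ≡⟨ cong (_+_ 1ℤ) (ℤ.neg-distribˡ-* (+ y) (+ N)) ⟩
    1ℤ + - + y * + N            ∎)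
    where
    open ≡-Reasoning
    rearrange : ∀ b x → b * - x ≡ 1ℤ - (1ℤ + x * b)
    rearrange = solve-∀

  infix 4 _≈±1
  _≈±1 : ℤ → Set
  x ≈±1 = x ≈ 1ℤ ⊎ x ≈ - 1ℤ

  ≈±1-respˡ : ∀ {x y} → x ≈ y → y ≈±1 → x ≈±1
  ≈±1-respˡ x≈y (inj₁ y≈1)  = inj₁ (≈-trans x≈y y≈1)
  ≈±1-respˡ x≈y (inj₂ y≈-1) = inj₂ (≈-trans x≈y y≈-1)

  -≈±1 : ∀ {x} → x ≈±1 → - x ≈±1
  -≈±1 (inj₁ x≈1)  = inj₂ (-‿cong x≈1)
  -≈±1 (inj₂ x≈-1) = inj₁ (-‿cong x≈-1)

  sign-≈±1 : ∀ i → (- 1ℤ) ^ i ≈±1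
  sign-≈±1 zero    = inj₁ ≈-refl
  sign-≈±1 (suc i) = ≈±1-respˡ (≡⇒≈ (ℤ.-1*i≡-i ((- 1ℤ) ^ i))) (-≈±1 (sign-≈±1 i))

  ≈±1⇒square≈1 : ∀ {x} → x ≈±1 → x * x ≈ 1ℤ
  ≈±1⇒square≈1 (inj₁ x≈1)  = *-cong x≈1 x≈1
  ≈±1⇒square≈1 (inj₂ x≈-1) = *-cong x≈-1 x≈-1

  private
    no-wrap : ∀ {r r′} m → r < N → r ≡ r′ ℕ.+ m ℕ.* N → r ≡ r′
    no-wrap zero    _   eq = trans eq (ℕ.+-identityʳ _)
    no-wrap {r′ = r′} (suc m) r<N refl = ⊥-elim (ℕ.<⇒≱ r<N (ℕ.≤-trans (ℕ.m≤m+n N (m ℕ.* N)) (ℕ.m≤n+m _ r′)))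

    no-wrapℤ : ∀ {r r′} m → r < N → + r ≡ + r′ + + m * + N → r ≡ r′
    no-wrapℤ {r} {r′} m r<N eq = no-wrap m r<N (ℤ.+-injective (begin
      + r                   ≡⟨ eq ⟩
      + r′ + + m * + N      ≡⟨ cong (_+_ (+ r′)) (ℤ.pos-* m N) ⟨
      + r′ + + (m ℕ.* N)    ≡⟨ ℤ.pos-+ r′ (m ℕ.* N) ⟨
      + (r′ ℕ.+ m ℕ.* N)    ∎))
      where open ≡-Reasoning

  <-≈-injective : ∀ {r₁ r₂} → r₁ < N → r₂ < N → + r₁ ≈ + r₂ → r₁ ≡ r₂
  <-≈-injective r₁<N _ (congruent (+ m) eq) = no-wrapℤ m r₁<N eq
  <-≈-injective {r₂ = r₂} _ r₂<N (congruent q@(-[1+ m ]) eq) =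
    sym (no-wrapℤ (suc m) r₂<N (trans (shift-back (+ r₂) q (+ N)) (cong (_+ - q * + N) (sym eq))))

  1≉0 : 2 ≤ N → ¬ (1ℤ ≈ 0ℤ)
  1≉0 2≤N 1≈0 with () ← <-≈-injective 2≤N (ℕ.<-trans (s≤s z≤n) 2≤N) 1≈0

  positive<N⇒≉0 : ∀ {x} → 0 < x → x < N → ¬ (+ x ≈ 0ℤ)
  positive<N⇒≉0 0<x x<N x≈0 = ℕ.<⇒≢ 0<x (sym (<-≈-injective x<N (ℕ.<-trans 0<x x<N) x≈0))

  ≈±1⇒≉0 : 2 ≤ N → ∀ {x} → x ≈±1 → ¬ (x ≈ 0ℤ)
  ≈±1⇒≉0 2≤N (inj₁ x≈1)  x≈0 = 1≉0 2≤N (≈-trans (≈-sym x≈1) x≈0)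
  ≈±1⇒≉0 2≤N (inj₂ x≈-1) x≈0 = 1≉0 2≤N (-‿cong (≈-trans (≈-sym x≈-1) x≈0))

module _ {m n : ℕ} where
  open Modulo m using () renaming (_≈_ to _≈ₘ_)
  open Modulo n using () renaming (_≈_ to _≈ₙ_)
  open Modulo (m ℕ.* n) using (congruent) renaming (_≈_ to _≈ₘₙ_)

  private
    cancel : ∀ y z → z ≡ (y + z) - y
    cancel = solve-∀

  chineseRemainder : Coprime m n → ∀ {x y} → x ≈ₘ y → x ≈ₙ y → x ≈ₘₙ y
  chineseRemainder m⊥n {y = y} (Modulo.congruent a x≡y+am) (Modulo.congruent b x≡y+bn)
    with ∣ᵤ⇒∣ {+ m} {b} (ℤ.coprime-divisor (+ m) (+ n) b m⊥n (divides ∣ a ∣ ∣nb∣≡∣a∣m))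
    where
    am≡bn : a * + m ≡ b * + n
    am≡bn = trans (cancel y (a * + m)) (trans (cong (_- y) (trans (sym x≡y+am) x≡y+bn)) (sym (cancel y (b * + n))))
    ∣nb∣≡∣a∣m : ∣ + n * b ∣ ≡ ∣ a ∣ ℕ.* m
    ∣nb∣≡∣a∣m = trans (cong ∣_∣ (trans (ℤ.*-comm (+ n) b) (sym am≡bn))) (ℤ.abs-* a (+ m))
  ... | divides c refl = congruent c (begin
    _                     ≡⟨ x≡y+bn ⟩
    y + c * + m * + n     ≡⟨ cong (_+_ y) (ℤ.*-assoc c (+ m) (+ n)) ⟩
    y + c * (+ m * + n)   ≡⟨ cong (λ mn → y + c * mn) (ℤ.pos-* m n) ⟨
    y + c * + (m ℕ.* n)   ∎)
    where open ≡-Reasoning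

  ≈ₘₙ⇒≈ₘ : ∀ {x y} → x ≈ₘₙ y → x ≈ₘ y
  ≈ₘₙ⇒≈ₘ {y = y} (congruent q refl) = Modulo.congruent (q * + n) (cong (_+_ y) (begin
    q * + (m ℕ.* n)    ≡⟨ cong (q *_) (ℤ.pos-* m n) ⟩
    q * (+ m * + n)    ≡⟨ cong (q *_) (ℤ.*-comm (+ m) (+ n)) ⟩
    q * (+ n * + m)    ≡⟨ ℤ.*-assoc q (+ n) (+ m) ⟨
    q * + n * + m      ∎))
    where open ≡-Reasoning

  ≈ₘₙ⇒≈ₙ : ∀ {x y} → x ≈ₘₙ y → x ≈ₙ y
  ≈ₘₙ⇒≈ₙ {y = y} (congruent q refl) = Modulo.congruent (q * + m) (cong (_+_ y) (begin
    q * + (m ℕ.* n)    ≡⟨ cong (q *_) (ℤ.pos-* m n) ⟩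
    q * (+ m * + n)    ≡⟨ ℤ.*-assoc q (+ m) (+ n) ⟨
    q * + m * + n      ∎))
    where open ≡-Reasoning

module Residues (N : ℕ) .{{_ : NonZero N}} where
  open Modulo N public

  toℤ : Fin N → ℤ
  toℤ a = + toℕ a

  fromℤ : ℤ → Fin N
  fromℤ x = fromℕ< (n%ℕd<d x N)

  toℤ-fromℤ : ∀ x → toℤ (fromℤ x) ≈ x
  toℤ-fromℤ x rewrite toℕ-fromℕ< (n%ℕd<d x N) = ≈-sym (congruent (x /ℕ N) (a≡a%ℕn+[a/ℕn]*n x N))

  toℤ-mod : ∀ m → toℤ (m mod N) ≈ + m
  toℤ-mod m rewrite toℕ-fromℕ< (m%n<n m N) = ≈-sym (congruent (+ (m / N)) (begin
    + m                           ≡⟨ cong +_ (m≡m%n+[m/n]*n m N) ⟩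
    + (m % N ℕ.+ m / N ℕ.* N)     ≡⟨ ℤ.pos-+ (m % N) (m / N ℕ.* N) ⟩
    + (m % N) + + (m / N ℕ.* N)   ≡⟨ cong (_+_ (+ (m % N))) (ℤ.pos-* (m / N) N) ⟩
    + (m % N) + + (m / N) * + N   ∎))
    where open ≡-Reasoning

  toℤ-≈-injective : ∀ {a b} → toℤ a ≈ toℤ b → a ≡ b
  toℤ-≈-injective {a} {b} a≈b = toℕ-injective (<-≈-injective (toℕ<n a) (toℕ<n b) a≈b)

  toℤ-⊞ : ∀ a b → toℤ (_⊞_ N a b) ≈ toℤ a + toℤ b
  toℤ-⊞ a b = ≈-trans (toℤ-mod (toℕ a ℕ.+ toℕ b)) (≡⇒≈ (ℤ.pos-+ (toℕ a) (toℕ b)))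

  toℤ-⊠ : ∀ a b → toℤ (_⊠_ N a b) ≈ toℤ a * toℤ b
  toℤ-⊠ a b = ≈-trans (toℤ-mod (toℕ a ℕ.* toℕ b)) (≡⇒≈ (ℤ.pos-* (toℕ a) (toℕ b)))

  toℤ-neg : ∀ a → toℤ (neg N a) ≈ - toℤ a
  toℤ-neg a = ≈-trans (toℤ-mod (N ℕ.∸ toℕ a)) (begin
    + (N ℕ.∸ toℕ a)     ≡⟨ ℤ.⊖-≥ (ℕ.<⇒≤ (toℕ<n a)) ⟨
    N ℤ.⊖ toℕ a         ≡⟨ ℤ.m-n≡m⊖n N (toℕ a) ⟨
    + N - toℤ a         ≈⟨ +-cong N≈0 (≈-refl {x = - toℤ a}) ⟩
    0ℤ - toℤ a          ≡⟨ ℤ.+-identityˡ (- toℤ a) ⟩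
    - toℤ a             ∎)
    where open ≈-Reasoning

  toℤ-zeroN : toℤ (zeroN N) ≈ 0ℤ
  toℤ-zeroN = toℤ-mod 0

  toℤ-oneN : toℤ (oneN N) ≈ 1ℤ
  toℤ-oneN = toℤ-mod 1

  toℤ-negOne : toℤ (neg N (oneN N)) ≈ - 1ℤ
  toℤ-negOne = ≈-trans (toℤ-neg (oneN N)) (-‿cong toℤ-oneN)

-- Integer matrices and Chebyshev polynomials

record IntMat : Set where
  constructor imat
  field
    e₁₁ e₁₂ e₂₁ e₂₂ : ℤ
open IntMat

infixl 7 _⊗_
_⊗_ : IntMat → IntMat → IntMat
imat a b c d ⊗ imat e f g h = imat (a * e + b * g) (a * f + b * h) (c * e + d * g) (c * f + d * h)

scalar : ℤ → IntMat
scalar e = imat e 0ℤ 0ℤ e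

Idℤ : IntMat
Idℤ = scalar 1ℤ

Mkℤ : ℤ → IntMat
Mkℤ a = imat a (- 1ℤ) 1ℤ 0ℤ

Mnℤ : List ℤ → IntMat
Mnℤ []       = Idℤ
Mnℤ (a ∷ as) = Mnℤ as ⊗ Mkℤ a

imat-cong : ∀ {a b c d a′ b′ c′ d′} → a ≡ a′ → b ≡ b′ → c ≡ c′ → d ≡ d′ →
            imat a b c d ≡ imat a′ b′ c′ d′
imat-cong refl refl refl refl = refl

private
  row-assoc : ∀ a b e f g h i j k l →
              (a * e + b * g) * i + (a * f + b * h) * k ≡ a * (e * i + f * k) + b * (g * i + h * k)
  row-assoc = solve-∀
  unit-left : ∀ a b → 1ℤ * a + 0ℤ * b ≡ a
  unit-left = solve-∀
  zero-left : ∀ a b → 0ℤ * a + 1ℤ * b ≡ b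
  zero-left = solve-∀
  unit-right : ∀ a b → a * 1ℤ + b * 0ℤ ≡ a
  unit-right = solve-∀
  zero-right : ∀ a b → a * 0ℤ + b * 1ℤ ≡ b
  zero-right = solve-∀

⊗-assoc : ∀ X Y Z → (X ⊗ Y) ⊗ Z ≡ X ⊗ (Y ⊗ Z)
⊗-assoc (imat a b c d) (imat e f g h) (imat i j k l) = imat-cong
  (row-assoc a b e f g h i j k l) (row-assoc a b e f g h j i l k)
  (row-assoc c d e f g h i j k l) (row-assoc c d e f g h j i l k)

⊗-identityˡ : ∀ X → Idℤ ⊗ X ≡ X
⊗-identityˡ (imat a b c d) = imat-cong (unit-left a c) (unit-left b d) (zero-left a c) (zero-left b d)

⊗-identityʳ : ∀ X → X ⊗ Idℤ ≡ X
⊗-identityʳ (imat a b c d) = imat-cong (unit-right a b) (zero-right a b) (unit-right c d) (zero-right c d)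

Mnℤ-∷ʳ : ∀ xs y → Mnℤ (xs ∷ʳ y) ≡ Mkℤ y ⊗ Mnℤ xs
Mnℤ-∷ʳ []       y = trans (⊗-identityˡ (Mkℤ y)) (sym (⊗-identityʳ (Mkℤ y)))
Mnℤ-∷ʳ (x ∷ xs) y = trans (cong (_⊗ Mkℤ x) (Mnℤ-∷ʳ xs y)) (⊗-assoc (Mkℤ y) (Mnℤ xs) (Mkℤ x))

module Chebyshev (k : ℤ) where

  s : ℕ → ℤ
  s zero          = 0ℤ
  s (suc zero)    = 1ℤ
  s (suc (suc j)) = k * s (suc j) - s j

  power : ℕ → IntMat
  power j = imat (s (suc j)) (- s j) (s j) (s (suc j) - k * s j)

  s-det : ∀ j → s (suc j) * s (suc j) - k * s (suc j) * s j + s j * s j ≡ 1ℤ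
  s-det zero    = base k
    where base : ∀ k → 1ℤ * 1ℤ - k * 1ℤ * 0ℤ + 0ℤ * 0ℤ ≡ 1ℤ
          base = solve-∀
  s-det (suc j) = trans (step (s (suc j)) (s j) k) (s-det j)
    where step : ∀ a b k → (k * a - b) * (k * a - b) - k * (k * a - b) * a + a * a ≡ a * a - k * a * b + b * b
          step = solve-∀

  Mnℤ-replicate : ∀ j → Mnℤ (replicate j k) ≡ power j
  Mnℤ-replicate zero    = imat-cong refl refl refl (base k)
    where base : ∀ k → 1ℤ ≡ 1ℤ - k * 0ℤ
          base = solve-∀
  Mnℤ-replicate (suc j) = trans (cong (_⊗ Mkℤ k) (Mnℤ-replicate j)) (imat-cong
    (e₁₁-step (s (suc j)) (s j) k) (e₁₂-step (s (suc j)) (s j)) (e₂₁-step (s (suc j)) (s j) k) (e₂₂-step (s (suc j)) (s j) k))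
    where
    e₁₁-step : ∀ a b k → a * k + (- b) * 1ℤ ≡ k * a - b
    e₁₁-step = solve-∀
    e₁₂-step : ∀ a b → a * (- 1ℤ) + (- b) * 0ℤ ≡ - a
    e₁₂-step = solve-∀
    e₂₁-step : ∀ a b k → b * k + (a - k * b) * 1ℤ ≡ a
    e₂₁-step = solve-∀
    e₂₂-step : ∀ a b k → b * (- 1ℤ) + (a - k * b) * 0ℤ ≡ (k * a - b) - k * a
    e₂₂-step = solve-∀

module ChebyshevModulo (N : ℕ) where
  open Modulo N
  open Chebyshev using (s)

  s-cong : ∀ {k k′} → k ≈ k′ → ∀ j → s k j ≈ s k′ j
  s-cong k≈k′ zero          = ≈-refl
  s-cong k≈k′ (suc zero)    = ≈-refl
  s-cong k≈k′ (suc (suc j)) = +-cong (*-cong k≈k′ (s-cong k≈k′ (suc j))) (-‿cong (s-cong k≈k′ j))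

  s-at-2 : ∀ {k} → k ≈ + 2 → ∀ j → s k j ≈ + j
  s-at-2 k≈2 zero          = ≈-refl
  s-at-2 k≈2 (suc zero)    = ≈-refl
  s-at-2 {k} k≈2 (suc (suc j)) = begin
    k * s k (suc j) - s k j   ≈⟨ +-cong (*-cong k≈2 (s-at-2 k≈2 (suc j))) (-‿cong (s-at-2 k≈2 j)) ⟩
    + 2 * + suc j - + j       ≡⟨ linear j ⟩
    + suc (suc j)             ∎
    where
    open ≈-Reasoning
    step : ∀ x → + 2 * (1ℤ + x) - x ≡ + 2 + x
    step = solve-∀
    linear : ∀ j → + 2 * + suc j - + j ≡ + suc (suc j)
    linear j = trans (cong (λ z → + 2 * z - + j) (ℤ.pos-+ 1 j)) (trans (step (+ j)) (sym (ℤ.pos-+ 2 j)))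

  s-at-1-antiperiodic : ∀ {k} → k ≈ 1ℤ → ∀ j → s k (3 ℕ.+ j) ≈ - s k j
  s-at-1-antiperiodic {k} k≈1 j = begin
    k * (k * s k (suc j) - s k j) - s k (suc j)    ≈⟨ +-cong (*-cong k≈1 (+-cong (*-cong k≈1 ≈-refl) ≈-refl)) ≈-refl ⟩
    1ℤ * (1ℤ * s k (suc j) - s k j) - s k (suc j)  ≡⟨ cancel (s k (suc j)) (s k j) ⟩
    - s k j                                        ∎
    where
    open ≈-Reasoning
    cancel : ∀ a b → 1ℤ * (1ℤ * a - b) - a ≡ - b
    cancel = solve-∀

  s-at-1-periodic : ∀ {k} → k ≈ 1ℤ → ∀ q r → s k (q ℕ.* 6 ℕ.+ r) ≈ s k r
  s-at-1-periodic k≈1 zero    r = ≈-refl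
  s-at-1-periodic {k} k≈1 (suc q) r = begin
    s k (6 ℕ.+ q ℕ.* 6 ℕ.+ r)      ≡⟨ cong (s k) (ℕ.+-assoc 6 (q ℕ.* 6) r) ⟩
    s k (3 ℕ.+ (3 ℕ.+ (q ℕ.* 6 ℕ.+ r))) ≈⟨ s-at-1-antiperiodic k≈1 (3 ℕ.+ (q ℕ.* 6 ℕ.+ r)) ⟩
    - s k (3 ℕ.+ (q ℕ.* 6 ℕ.+ r))  ≈⟨ -‿cong (s-at-1-antiperiodic k≈1 (q ℕ.* 6 ℕ.+ r)) ⟩
    - - s k (q ℕ.* 6 ℕ.+ r)        ≡⟨ ℤ.neg-involutive _ ⟩
    s k (q ℕ.* 6 ℕ.+ r)            ≈⟨ s-at-1-periodic k≈1 q r ⟩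
    s k r                          ∎
    where open ≈-Reasoning

  s-nilpotent : ∀ {k} → k * k ≈ 0ℤ → ∀ i →
                s k (i ℕ.+ i) ≈ - ((- 1ℤ) ^ i * (+ i * k)) × s k (suc (i ℕ.+ i)) ≈ (- 1ℤ) ^ i
  s-nilpotent {k} k²≈0 zero    = ≡⇒≈ (initial k) , ≈-refl
    where initial : ∀ k → 0ℤ ≡ - (1ℤ * (+ 0 * k))
          initial = solve-∀
  s-nilpotent {k} k²≈0 (suc i) rewrite ℕ.+-suc i i =
    even , (begin
      k * s k (2 ℕ.+ (i ℕ.+ i)) - s k (suc (i ℕ.+ i))  ≈⟨ +-cong (*-cong (≈-refl {x = k}) even) (-‿cong odd) ⟩
      k * - (σ′ * (+ suc i * k)) - σ                   ≡⟨ odd-step k σ (+ suc i) ⟩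
      σ * + suc i * (k * k) - σ                         ≈⟨ +-cong (*-cong (≈-refl {x = σ * + suc i}) k²≈0) (≈-refl {x = - σ}) ⟩
      σ * + suc i * 0ℤ - σ                              ≡⟨ vanish (σ * + suc i) σ ⟩
      σ′                                                ∎)
    where
    open ≈-Reasoning
    σ σ′ : ℤ
    σ = (- 1ℤ) ^ i
    σ′ = (- 1ℤ) ^ suc i
    even-now : s k (i ℕ.+ i) ≈ - (σ * (+ i * k))
    even-now = proj₁ (s-nilpotent k²≈0 i)
    odd : s k (suc (i ℕ.+ i)) ≈ σ
    odd = proj₂ (s-nilpotent k²≈0 i)
    even-step : ∀ k σ i → k * σ - - (σ * (i * k)) ≡ - (- 1ℤ * σ * ((1ℤ + i) * k))
    even-step = solve-∀
    odd-step : ∀ k σ i → k * - (- 1ℤ * σ * (i * k)) - σ ≡ σ * i * (k * k) - σ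
    odd-step = solve-∀
    vanish : ∀ a σ → a * 0ℤ - σ ≡ - 1ℤ * σ
    vanish = solve-∀
    even : s k (2 ℕ.+ (i ℕ.+ i)) ≈ - (σ′ * (+ suc i * k))
    even = begin
      k * s k (suc (i ℕ.+ i)) - s k (i ℕ.+ i)   ≈⟨ +-cong (*-cong (≈-refl {x = k}) odd) (-‿cong even-now) ⟩
      k * σ - - (σ * (+ i * k))                  ≡⟨ even-step k σ (+ i) ⟩
      - (σ′ * ((1ℤ + + i) * k))                  ≡⟨ cong (λ z → - (σ′ * (z * k))) (ℤ.pos-+ 1 i) ⟨
      - (σ′ * (+ suc i * k))                     ∎

module Lifting (N : ℕ) .{{_ : NonZero N}} where
  open Residues N public

  infix 4 _≈ᴹ_
  record _≈ᴹ_ (X Y : IntMat) : Set where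
    constructor entrywise
    field
      ≈₁₁ : e₁₁ X ≈ e₁₁ Y
      ≈₁₂ : e₁₂ X ≈ e₁₂ Y
      ≈₂₁ : e₂₁ X ≈ e₂₁ Y
      ≈₂₂ : e₂₂ X ≈ e₂₂ Y
  open _≈ᴹ_ public

  ≡⇒≈ᴹ : ∀ {X Y} → X ≡ Y → X ≈ᴹ Y
  ≡⇒≈ᴹ refl = entrywise ≈-refl ≈-refl ≈-refl ≈-refl

  ≈ᴹ-sym : ∀ {X Y} → X ≈ᴹ Y → Y ≈ᴹ X
  ≈ᴹ-sym (entrywise a b c d) = entrywise (≈-sym a) (≈-sym b) (≈-sym c) (≈-sym d)

  ≈ᴹ-trans : ∀ {X Y Z} → X ≈ᴹ Y → Y ≈ᴹ Z → X ≈ᴹ Z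
  ≈ᴹ-trans (entrywise a b c d) (entrywise a′ b′ c′ d′) =
    entrywise (≈-trans a a′) (≈-trans b b′) (≈-trans c c′) (≈-trans d d′)

  ⊗-cong : ∀ {X X′ Y Y′} → X ≈ᴹ X′ → Y ≈ᴹ Y′ → X ⊗ Y ≈ᴹ X′ ⊗ Y′
  ⊗-cong {imat _ _ _ _} {imat _ _ _ _} {imat _ _ _ _} {imat _ _ _ _} (entrywise a b c d) (entrywise e f g h) =
    entrywise (+-cong (*-cong a e) (*-cong b g)) (+-cong (*-cong a f) (*-cong b h))
              (+-cong (*-cong c e) (*-cong d g)) (+-cong (*-cong c f) (*-cong d h))

  lift : Mat N → IntMat
  lift (mat a b c d) = imat (toℤ a) (toℤ b) (toℤ c) (toℤ d)

  lift-≈ᴹ-injective : ∀ {M M′} → lift M ≈ᴹ lift M′ → M ≡ M′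
  lift-≈ᴹ-injective {mat _ _ _ _} {mat _ _ _ _} (entrywise a b c d)
    rewrite toℤ-≈-injective a | toℤ-≈-injective b | toℤ-≈-injective c | toℤ-≈-injective d = refl

  private
    toℤ-entry : ∀ a e b g → toℤ (_⊞_ N (_⊠_ N a e) (_⊠_ N b g)) ≈ toℤ a * toℤ e + toℤ b * toℤ g
    toℤ-entry a e b g = ≈-trans (toℤ-⊞ (_⊠_ N a e) (_⊠_ N b g)) (+-cong (toℤ-⊠ a e) (toℤ-⊠ b g))

  lift-· : ∀ M M′ → lift (_·_ N M M′) ≈ᴹ lift M ⊗ lift M′
  lift-· (mat a b c d) (mat e f g h) =
    entrywise (toℤ-entry a e b g) (toℤ-entry a f b h) (toℤ-entry c e d g) (toℤ-entry c f d h)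

  lift-Id : lift (Id N) ≈ᴹ Idℤ
  lift-Id = entrywise toℤ-oneN toℤ-zeroN toℤ-zeroN toℤ-oneN

  lift-negId : lift (negId N) ≈ᴹ scalar (- 1ℤ)
  lift-negId = entrywise toℤ-negOne toℤ-zeroN toℤ-zeroN toℤ-negOne

  lift-Mk : ∀ a → lift (Mk N a) ≈ᴹ Mkℤ (toℤ a)
  lift-Mk a = entrywise ≈-refl toℤ-negOne toℤ-oneN toℤ-zeroN

  lift-Mn : ∀ as → lift (Mn N as) ≈ᴹ Mnℤ (map toℤ as)
  lift-Mn []       = lift-Id
  lift-Mn (a ∷ as) = ≈ᴹ-trans (lift-· (Mn N as) (Mk N a)) (⊗-cong (lift-Mn as) (lift-Mk a))

  lift-≡⇔ : ∀ {M M′ X Y} → lift M ≈ᴹ X → lift M′ ≈ᴹ Y → (M ≡ M′) ⇔ (X ≈ᴹ Y)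
  lift-≡⇔ M≈X M′≈Y = mk⇔
    (λ { refl → ≈ᴹ-trans (≈ᴹ-sym M≈X) M′≈Y })
    (λ X≈Y → lift-≈ᴹ-injective (≈ᴹ-trans M≈X (≈ᴹ-trans X≈Y (≈ᴹ-sym M′≈Y))))

  solution⇔ : ∀ as {X} → lift (Mn N as) ≈ᴹ X → Solution N as ⇔ (X ≈ᴹ Idℤ ⊎ X ≈ᴹ scalar (- 1ℤ))
  solution⇔ _ lifted = lift-≡⇔ lifted lift-Id ⊎-⇔ lift-≡⇔ lifted lift-negId

  Mkℤ-cong : ∀ {a a′} → a ≈ a′ → Mkℤ a ≈ᴹ Mkℤ a′
  Mkℤ-cong a≈a′ = entrywise a≈a′ ≈-refl ≈-refl ≈-refl

  scalar-cong : ∀ {e e′} → e ≈ e′ → scalar e ≈ᴹ scalar e′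
  scalar-cong e≈e′ = entrywise e≈e′ ≈-refl ≈-refl e≈e′

  lift-Mn-∷ʳ : ∀ xs b → lift (Mn N (xs ∷ʳ b)) ≈ᴹ Mkℤ (toℤ b) ⊗ Mnℤ (map toℤ xs)
  lift-Mn-∷ʳ xs b = ≈ᴹ-trans (lift-Mn (xs ∷ʳ b)) (≡⇒≈ᴹ (begin
    Mnℤ (map toℤ (xs ∷ʳ b))      ≡⟨ cong Mnℤ (map-++ toℤ xs (b ∷ [])) ⟩
    Mnℤ (map toℤ xs ∷ʳ toℤ b)    ≡⟨ Mnℤ-∷ʳ (map toℤ xs) (toℤ b) ⟩
    Mkℤ (toℤ b) ⊗ Mnℤ (map toℤ xs) ∎))
    where open ≡-Reasoning

  _≟ᴹ_ : DecidableEquality (Mat N)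
  mat a b c d ≟ᴹ mat a′ b′ c′ d′ =
    map′ (λ { (refl , refl , refl , refl) → refl }) (λ { refl → refl , refl , refl , refl })
         (a ≟ a′ ×-dec b ≟ b′ ×-dec c ≟ c′ ×-dec d ≟ d′)

  solution? : ∀ as → Dec (Solution N as)
  solution? as = (Mn N as ≟ᴹ Id N) ⊎-dec (Mn N as ≟ᴹ negId N)

  toℤ-≡⇔ : ∀ {a b x e} → toℤ a ≈ x → toℤ b ≈ e → (x ≈ e) ⇔ (a ≡ b)
  toℤ-≡⇔ a≈x b≈e = mk⇔
    (λ x≈e → toℤ-≈-injective (≈-trans a≈x (≈-trans x≈e (≈-sym b≈e))))
    (λ { refl → ≈-trans (≈-sym a≈x) b≈e })

-- Monomial solutions and their splittings

module Words (N : ℕ) .{{_ : NonZero N}} where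

  unsnoc-∷ʳ : ∀ (xs : List (Fin N)) y → unsnoc N (xs ∷ʳ y) ≡ just (xs , y)
  unsnoc-∷ʳ []       y = refl
  unsnoc-∷ʳ (x ∷ xs) y rewrite unsnoc-∷ʳ xs y = refl

  ⊕-∷ʳ : ∀ a as a′ b bs b′ →
         _⊕_ N (a ∷ (as ∷ʳ a′)) (b ∷ (bs ∷ʳ b′)) ≡ _⊞_ N a b′ ∷ as ++ _⊞_ N a′ b ∷ bs
  ⊕-∷ʳ a as a′ b bs b′ rewrite unsnoc-∷ʳ as a′ | unsnoc-∷ʳ bs b′ = refl

  length-∷-∷ʳ : ∀ (x : Fin N) xs y → length (x ∷ (xs ∷ʳ y)) ≡ 2 ℕ.+ length xs
  length-∷-∷ʳ x xs y = cong suc (trans (length-++ xs) (ℕ.+-comm (length xs) 1))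

  length-rotate : ∀ k (xs : List (Fin N)) → length (rotate N k xs) ≡ length xs
  length-rotate k xs = begin
    length (drop k xs ++ take k xs)                ≡⟨ length-++ (drop k xs) ⟩
    length (drop k xs) ℕ.+ length (take k xs)      ≡⟨ cong₂ ℕ._+_ (length-drop k xs) (length-take k xs) ⟩
    (length xs ℕ.∸ k) ℕ.+ (k ℕ.⊓ length xs)        ≡⟨ ℕ.+-comm (length xs ℕ.∸ k) _ ⟩
    (k ℕ.⊓ length xs) ℕ.+ (length xs ℕ.∸ k)        ≡⟨ ℕ.m⊓n+n∸m≡n k (length xs) ⟩
    length xs                                      ∎
    where open ≡-Reasoning

  rotate-All : ∀ {P : Fin N → Set} k {xs} → All P xs → All P (rotate N k xs)
  rotate-All k Pxs = All.++⁺ (All.drop⁺ k Pxs) (All.take⁺ k Pxs)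

  ∼-replicate : ∀ n c {zs} → _∼_ N (replicate n c) zs → zs ≡ replicate n c
  ∼-replicate n c (k , zs≡) = rotation-replicate
    ([ id , (λ zs≡′ → trans zs≡′ (cong (rotate N k) (reverse-replicate n c))) ]′ zs≡)
    where
    rotation-replicate : ∀ {zs} → zs ≡ rotate N k (replicate n c) → zs ≡ replicate n c
    rotation-replicate refl = trans (All≡⇒replicate _ (rotate-All k (All.replicate⁺ n refl)))
      (cong (λ m → replicate m c) (trans (length-rotate k _) (length-replicate n)))

module Monomial (N : ℕ) .{{_ : NonZero N}} (c : Fin N) where
  open Lifting N public
  open Chebyshev (toℤ c) public

  k : ℤ
  k = toℤ c

  lift-replicate : ∀ j → lift (Mn N (replicate j c)) ≈ᴹ power j
  lift-replicate j = ≈ᴹ-trans (lift-Mn (replicate j c))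
    (≡⇒≈ᴹ (trans (cong Mnℤ (map-replicate toℤ j c)) (Mnℤ-replicate j)))

  power≈ᴹscalar⇔ : ∀ j e → power j ≈ᴹ scalar e ⇔ (s j ≈ 0ℤ × s (suc j) ≈ e)
  power≈ᴹscalar⇔ j e = mk⇔ (λ P≈e → ≈₂₁ P≈e , ≈₁₁ P≈e) λ (sj≈0 , y≈e) →
    entrywise y≈e (-‿cong sj≈0) sj≈0 (begin
      s (suc j) - k * s j   ≈⟨ +-cong y≈e (-‿cong (*-cong (≈-refl {k}) sj≈0)) ⟩
      e - k * 0ℤ            ≡⟨ cancel e k ⟩
      e                     ∎)
    where
    open ≈-Reasoning
    cancel : ∀ e k → e - k * 0ℤ ≡ e
    cancel = solve-∀

  replicate-solution⇔ : ∀ j → Solution N (replicate j c) ⇔ (s j ≈ 0ℤ × s (suc j) ≈±1)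
  replicate-solution⇔ j = ⇔.trans (solution⇔ (replicate j c) (lift-replicate j))
    (⇔.trans (power≈ᴹscalar⇔ j 1ℤ ⊎-⇔ power≈ᴹscalar⇔ j (- 1ℤ)) (⇔.sym (↔⇒⇔ (×-distribˡ-⊎ _ _ _ _))))

  lift-block : ∀ L b b′ → lift (Mn N (b ∷ (replicate L c ∷ʳ b′))) ≈ᴹ Mkℤ (toℤ b′) ⊗ power L ⊗ Mkℤ (toℤ b)
  lift-block L b b′ = ≈ᴹ-trans (lift-· (Mn N (replicate L c ∷ʳ b′)) (Mk N b))
    (⊗-cong (≈ᴹ-trans (lift-Mn-∷ʳ (replicate L c) b′)
                      (≡⇒≈ᴹ (cong (Mkℤ (toℤ b′) ⊗_) (trans (cong Mnℤ (map-replicate toℤ L c)) (Mnℤ-replicate L)))))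
            (lift-Mk b))

  block-e₂₂ : ∀ a a′ L → e₂₂ (Mkℤ a′ ⊗ power L ⊗ Mkℤ a) ≡ - s (suc L)
  block-e₂₂ a a′ L = entry (s (suc L)) (- s L) (s L) (s (suc L) - k * s L)
    where entry : ∀ p q r t → (1ℤ * p + 0ℤ * r) * - 1ℤ + (1ℤ * q + 0ℤ * t) * 0ℤ ≡ - p
          entry = solve-∀

  block-solution⇒ : ∀ L b b′ → Solution N (b ∷ (replicate L c ∷ʳ b′)) → s (suc L) ≈±1
  block-solution⇒ L b b′ sol = ≈±1-respˡ (≡⇒≈ (sym (ℤ.neg-involutive (s (suc L)))))
    (-≈±1 (≈±1-respˡ (≡⇒≈ (sym (block-e₂₂ (toℤ b) (toℤ b′) L)))
      (Sum.map ≈₂₂ ≈₂₂ (Equivalence.to (solution⇔ (b ∷ (replicate L c ∷ʳ b′)) (lift-block L b b′)) sol))))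

  -- With y = s (L+1) and x = s L, the entries of Mkℤ (y x) ⊗ power L ⊗ Mkℤ (y x) differ from
  -- those of scalar (- y) by multiples of y² - 1 and of the determinant minus 1.
  symmetric-block : ∀ L → s (suc L) * s (suc L) ≈ 1ℤ →
                    Mkℤ (s (suc L) * s L) ⊗ power L ⊗ Mkℤ (s (suc L) * s L) ≈ᴹ scalar (- s (suc L))
  symmetric-block L y²≈1 = entrywise
    (begin
      _                            ≡⟨ entry₁₁ y x k ⟩
      - y + (u * (y * x * x + y - k * x) - y * (D - 1ℤ))
        ≈⟨ +-cong (≈-refl {x = - y}) (+-cong (u≈0-absorbs _) (-‿cong (*-cong (≈-refl {x = y}) (≡⇒≈ D-1≡0)))) ⟩
      - y + (0ℤ - y * 0ℤ)          ≡⟨ vanish y ⟩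
      - y                          ∎)
    (≈-trans (≡⇒≈ (entry₁₂ y x k)) (-‿cong (u≈0-absorbs x)))
    (≈-trans (≡⇒≈ (entry₂₁ y x k)) (u≈0-absorbs x))
    (≡⇒≈ (entry₂₂ y x k))
    where
    open ≈-Reasoning
    y = s (suc L)
    x = s L
    u = y * y - 1ℤ
    D = y * y - k * y * x + x * x
    D-1≡0 : D - 1ℤ ≡ 0ℤ
    D-1≡0 = cong (_- 1ℤ) (s-det L)
    u≈0-absorbs : ∀ z → u * z ≈ 0ℤ
    u≈0-absorbs z = ≈-trans (*-cong (+-cong y²≈1 (≈-refl {x = - 1ℤ})) (≈-refl {x = z})) (≡⇒≈ (ℤ.*-zeroˡ z))
    vanish : ∀ y → - y + (0ℤ - y * 0ℤ) ≡ - y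
    vanish = solve-∀
    entry₁₁ : ∀ y x k → (y * x * y + - 1ℤ * x) * (y * x) + (y * x * - x + - 1ℤ * (y - k * x)) * 1ℤ
                    ≡ - y + ((y * y - 1ℤ) * (y * x * x + y - k * x) - y * ((y * y - k * y * x + x * x) - 1ℤ))
    entry₁₁ = solve-∀
    entry₁₂ : ∀ y x k → (y * x * y + - 1ℤ * x) * - 1ℤ + (y * x * - x + - 1ℤ * (y - k * x)) * 0ℤ ≡ - ((y * y - 1ℤ) * x)
    entry₁₂ = solve-∀
    entry₂₁ : ∀ y x k → (1ℤ * y + 0ℤ * x) * (y * x) + (1ℤ * - x + 0ℤ * (y - k * x)) * 1ℤ ≡ (y * y - 1ℤ) * x
    entry₂₁ = solve-∀
    entry₂₂ : ∀ y x k → (1ℤ * y + 0ℤ * x) * - 1ℤ + (1ℤ * - x + 0ℤ * (y - k * x)) * 0ℤ ≡ - y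
    entry₂₂ = solve-∀

  block-solution⇐ : ∀ L → s (suc L) ≈±1 → ∃[ b ] Solution N (b ∷ (replicate L c ∷ʳ b))
  block-solution⇐ L y≈±1 = b , Equivalence.from (solution⇔ (b ∷ (replicate L c ∷ʳ b)) lifted)
      (Sum.map scalar-cong scalar-cong (-≈±1 y≈±1))
    where
    b : Fin N
    b = fromℤ (s (suc L) * s L)
    Mkb≈ : Mkℤ (toℤ b) ≈ᴹ Mkℤ (s (suc L) * s L)
    Mkb≈ = Mkℤ-cong (toℤ-fromℤ (s (suc L) * s L))
    lifted : lift (Mn N (b ∷ (replicate L c ∷ʳ b))) ≈ᴹ scalar (- s (suc L))
    lifted = ≈ᴹ-trans (lift-block L b b)
      (≈ᴹ-trans (⊗-cong (⊗-cong Mkb≈ (≡⇒≈ᴹ refl)) Mkb≈) (symmetric-block L (≈±1⇒square≈1 y≈±1)))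

  open Words N

  BlockWithin : ℕ → Set
  BlockWithin n = ∃[ L ] 1 ≤ L × L ℕ.+ 3 ≤ n × s (suc L) ≈±1

  private
    3≤length⇔ : ∀ (x : Fin N) xs y → 3 ≤ length (x ∷ (xs ∷ʳ y)) ⇔ 1 ≤ length xs
    3≤length⇔ x xs y rewrite length-∷-∷ʳ x xs y = mk⇔ (ℕ.+-cancelˡ-≤ 2 1 (length xs)) (ℕ.+-monoʳ-≤ 2)

    +3≤ : ∀ A L → 1 ≤ A → L ℕ.+ 3 ≤ suc (A ℕ.+ suc L)
    +3≤ (suc A) L _ = subst (_≤ suc (suc A ℕ.+ suc L)) (ℕ.+-comm 3 L) (s≤s (s≤s (ℕ.m≤n+m (suc L) A)))

    blockWithin-split : ∀ {n} x as y b bs b′ → Solution N (b ∷ (bs ∷ʳ b′)) →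
                        1 ≤ length as → 1 ≤ length bs → x ∷ as ++ y ∷ bs ≡ replicate n c → BlockWithin n
    blockWithin-split {n} x as y b bs b′ sol 1≤as 1≤bs split≡ =
      length bs , 1≤bs , subst (length bs ℕ.+ 3 ≤_) length≡ (+3≤ (length as) (length bs) 1≤as) ,
      block-solution⇒ (length bs) b b′ (subst (λ ws → Solution N (b ∷ (ws ∷ʳ b′))) bs≡ sol)
      where
      bs≡ : bs ≡ replicate (length bs) c
      bs≡ with All.++⁻ʳ (x ∷ as) (subst (All (_≡ c)) (sym split≡) (All.replicate⁺ n refl))
      ... | _ ∷ All≡c = All≡⇒replicate bs All≡c
      length≡ : suc (length as ℕ.+ suc (length bs)) ≡ n
      length≡ = trans (cong suc (sym (length-++ as))) (trans (cong length split≡) (length-replicate n))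

  reducible⇒blockWithin : ∀ n → Reducible N (replicate n c) → BlockWithin n
  reducible⇒blockWithin n (_ , x ∷ xs , y ∷ ys , sol , 3≤a , 3≤b , c^n∼a⊕b) with initLast xs | initLast ys
  ... | as ∷ʳ′ aₙ | bs ∷ʳ′ bₘ =
    blockWithin-split _ as _ y bs bₘ sol (to (3≤length⇔ x as aₙ) 3≤a) (to (3≤length⇔ y bs bₘ) 3≤b)
      (trans (sym (⊕-∷ʳ x as aₙ y bs bₘ)) (∼-replicate n c c^n∼a⊕b))
    where open Equivalence
  ... | [] | _ with s≤s () ← 3≤a
  ... | _ ∷ʳ′ _ | [] with s≤s () ← 3≤b

  private
    split-reducible : ∀ L t b → 1 ≤ L → Solution N (b ∷ (replicate L c ∷ʳ b)) →
                      Reducible N (replicate (L ℕ.+ 3 ℕ.+ t) c)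
    split-reducible L t b 1≤L sol =
      3≤length , a , b ∷ (replicate L c ∷ʳ b) , sol ,
      from (3≤length⇔ a₁ (replicate (suc t) c) a₁) (s≤s z≤n) ,
      from (3≤length⇔ b (replicate L c) b) (subst (1 ≤_) (sym (length-replicate L)) 1≤L) ,
      0 , inj₁ a⊕b≡
      where
      open Equivalence
      a₁ = fromℤ (k - toℤ b)
      a = a₁ ∷ (replicate (suc t) c ∷ʳ a₁)
      3≤length : 3 ≤ length (replicate (L ℕ.+ 3 ℕ.+ t) c)
      3≤length = subst (3 ≤_) (sym (length-replicate (L ℕ.+ 3 ℕ.+ t)))
                   (ℕ.≤-trans (ℕ.m≤n+m 3 L) (ℕ.m≤m+n (L ℕ.+ 3) t))
      a₁⊞b≡c : _⊞_ N a₁ b ≡ c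
      a₁⊞b≡c = toℤ-≈-injective (begin
        toℤ (_⊞_ N a₁ b)       ≈⟨ toℤ-⊞ a₁ b ⟩
        toℤ a₁ + toℤ b         ≈⟨ +-cong (toℤ-fromℤ (k - toℤ b)) (≈-refl {x = toℤ b}) ⟩
        (k - toℤ b) + toℤ b    ≡⟨ cancel k (toℤ b) ⟩
        k                      ∎)
        where
        open ≈-Reasoning
        cancel : ∀ x y → (x - y) + y ≡ x
        cancel = solve-∀
      lengths : ∀ t L → suc (suc t ℕ.+ suc L) ≡ L ℕ.+ 3 ℕ.+ t
      lengths = ℕ-Solver.solve-∀
      a⊕b≡ : _⊕_ N a (b ∷ (replicate L c ∷ʳ b)) ≡ rotate N 0 (replicate (L ℕ.+ 3 ℕ.+ t) c)
      a⊕b≡ = begin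
        _⊕_ N a (b ∷ (replicate L c ∷ʳ b))                   ≡⟨ ⊕-∷ʳ a₁ (replicate (suc t) c) a₁ b (replicate L c) b ⟩
        _⊞_ N a₁ b ∷ replicate (suc t) c ++ _⊞_ N a₁ b ∷ replicate L c
                                                             ≡⟨ cong (λ z → z ∷ replicate (suc t) c ++ z ∷ replicate L c) a₁⊞b≡c ⟩
        replicate (suc (suc t)) c ++ replicate (suc L) c     ≡⟨ replicate-+ (suc (suc t)) (suc L) c ⟨
        replicate (suc (suc t) ℕ.+ suc L) c                  ≡⟨ cong (λ m → replicate m c) (lengths t L) ⟩
        replicate (L ℕ.+ 3 ℕ.+ t) c                          ≡⟨ ++-identityʳ _ ⟨
        rotate N 0 (replicate (L ℕ.+ 3 ℕ.+ t) c)             ∎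
        where open ≡-Reasoning

  blockWithin⇒reducible : ∀ n → BlockWithin n → Reducible N (replicate n c)
  blockWithin⇒reducible n (L , 1≤L , L+3≤n , y≈±1) =
    subst (λ m → Reducible N (replicate m c)) (ℕ.m+[n∸m]≡n L+3≤n)
      (split-reducible L (n ℕ.∸ (L ℕ.+ 3)) _ 1≤L (proj₂ (block-solution⇐ L y≈±1)))

  private
    replicate-1-¬solution : 2 ≤ N → ¬ Solution N (replicate 1 c)
    replicate-1-¬solution 2≤N sol = 1≉0 2≤N (proj₁ (Equivalence.to (replicate-solution⇔ 1) sol))

    replicate-2-solution⇒c≡0 : Solution N (replicate 2 c) → c ≡ zeroN N
    replicate-2-solution⇒c≡0 sol = toℤ-≈-injective (begin
      k              ≡⟨ s₂≡k k ⟩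
      k * 1ℤ - 0ℤ    ≈⟨ proj₁ (Equivalence.to (replicate-solution⇔ 2) sol) ⟩
      0ℤ             ≈⟨ toℤ-zeroN ⟨
      toℤ (zeroN N)  ∎)
      where
      open ≈-Reasoning
      s₂≡k : ∀ k → k ≡ k * 1ℤ - 0ℤ
      s₂≡k = solve-∀

  minimalSize≥3 : 2 ≤ N → c ≢ zeroN N → ∀ {n} → IsMonomialMinimalSize N c n → 3 ≤ n
  minimalSize≥3 2≤N c≢0 {1}           (_ , sol , _) = ⊥-elim (replicate-1-¬solution 2≤N sol)
  minimalSize≥3 2≤N c≢0 {2}           (_ , sol , _) = ⊥-elim (c≢0 (replicate-2-solution⇒c≡0 sol))
  minimalSize≥3 2≤N c≢0 {suc (suc (suc n))} _ = s≤s (s≤s (s≤s z≤n))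

  irreducible⇔¬blockWithin : 2 ≤ N → c ≢ zeroN N → ∀ {n} → IsMonomialMinimalSize N c n →
                             Irreducible N (replicate n c) ⇔ (¬ BlockWithin n)
  irreducible⇔¬blockWithin 2≤N c≢0 {n} minimal@(_ , sol , _) = mk⇔
    (λ (_ , _ , ¬reducible) → ¬reducible ∘ blockWithin⇒reducible n)
    (λ ¬block → sol , subst (3 ≤_) (sym (length-replicate n)) (minimalSize≥3 2≤N c≢0 minimal) ,
                ¬block ∘ reducible⇒blockWithin n)

  s-det-unit : ∀ L → s (suc L) * s (suc L) ≈ 1ℤ → s L * (s L - k * s (suc L)) ≈ 0ℤ
  s-det-unit L y²≈1 = begin
    x * (x - k * y)                    ≡⟨ expand x y k ⟩
    (y * y - k * y * x + x * x) - y * y ≡⟨ cong (_- y * y) (s-det L) ⟩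
    1ℤ - y * y                          ≈⟨ +-cong (≈-refl {x = 1ℤ}) (-‿cong y²≈1) ⟩
    1ℤ - 1ℤ                             ≡⟨⟩
    0ℤ                                  ∎
    where
    open ≈-Reasoning
    y = s (suc L)
    x = s L
    expand : ∀ x y k → x * (x - k * y) ≡ (y * y - k * y * x + x * x) - y * y
    expand = solve-∀

  s-reflect : ∀ L → s L ≈ k * s (suc L) → s (2 ℕ.+ L) ≈ 0ℤ × s (3 ℕ.+ L) ≈ - s (suc L)
  s-reflect L x≈ky = s₂≈0 , (begin
      k * s (2 ℕ.+ L) - s (suc L)   ≈⟨ +-cong (*-cong (≈-refl {x = k}) s₂≈0) (≈-refl {x = - s (suc L)}) ⟩
      k * 0ℤ - s (suc L)            ≡⟨ drop-zero k (s (suc L)) ⟩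
      - s (suc L)                   ∎)
    where
    open ≈-Reasoning
    drop-zero : ∀ k y → k * 0ℤ - y ≡ - y
    drop-zero = solve-∀
    s₂≈0 : s (2 ℕ.+ L) ≈ 0ℤ
    s₂≈0 = begin
      k * s (suc L) - s L             ≈⟨ +-cong (≈-refl {x = k * s (suc L)}) (-‿cong x≈ky) ⟩
      k * s (suc L) - k * s (suc L)   ≡⟨ ℤ.+-inverseʳ (k * s (suc L)) ⟩
      0ℤ                              ∎

  prime⇒¬blockWithin : Prime N → ∀ {n} → IsMonomialMinimalSize N c n → ¬ BlockWithin n
  prime⇒¬blockWithin N-prime {n} (_ , _ , shortest) (L , 1≤L , L+3≤n , y≈±1)
    with prime-*≈0 N-prime (s L) (s L - k * s (suc L)) (s-det-unit L (≈±1⇒square≈1 y≈±1))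
  ... | inj₁ x≈0 = shortest L 1≤L (ℕ.<-≤-trans (ℕ.m<m+n L (s≤s z≤n)) L+3≤n)
      (Equivalence.from (replicate-solution⇔ L) (x≈0 , y≈±1))
  ... | inj₂ x-ky≈0 = shortest (2 ℕ.+ L) (s≤s z≤n) (subst (_≤ n) (ℕ.+-comm L 3) L+3≤n)
      (Equivalence.from (replicate-solution⇔ (2 ℕ.+ L)) (proj₁ reflected , ≈±1-respˡ (proj₂ reflected) (-≈±1 y≈±1)))
    where
    reflected : s (2 ℕ.+ L) ≈ 0ℤ × s (3 ℕ.+ L) ≈ - s (suc L)
    reflected = s-reflect L (x-y≈0⇒x≈y x-ky≈0)

  s≈±1⇔ : ∀ L → let m = Mat.m11 (Mn N (replicate L c)) in
          s (suc L) ≈±1 ⇔ (m ≡ oneN N ⊎ m ≡ neg N (oneN N))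
  s≈±1⇔ L = toℤ-≡⇔ m≈y toℤ-oneN ⊎-⇔ toℤ-≡⇔ m≈y toℤ-negOne
    where
    m≈y : toℤ (Mat.m11 (Mn N (replicate L c))) ≈ s (suc L)
    m≈y = ≈₁₁ (lift-replicate L)

  s≈±1? : ∀ L → Dec (s (suc L) ≈±1)
  s≈±1? L = Dec.map (⇔.sym (s≈±1⇔ L)) ((_ ≟ oneN N) ⊎-dec (_ ≟ neg N (oneN N)))

  private
    +3≤⇒< : ∀ {L n} → L ℕ.+ 3 ≤ n → L < n
    +3≤⇒< {L} L+3≤n = ℕ.<-≤-trans (ℕ.m<m+n L (s≤s z≤n)) L+3≤n

  blockWithin? : ∀ n → Dec (BlockWithin n)
  blockWithin? n = map′ (λ (L , _ , block) → L , block) (λ (L , block) → L , +3≤⇒< (proj₁ (proj₂ block)) , block)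
    (any<? (λ L → (1 ℕ.≤? L) ×-dec (L ℕ.+ 3 ℕ.≤? n) ×-dec s≈±1? L) n)

  blockWithin-mono : ∀ {n n′} → n ≤ n′ → BlockWithin n → BlockWithin n′
  blockWithin-mono n≤n′ (L , 1≤L , L+3≤n , y≈±1) = L , 1≤L , ℕ.≤-trans L+3≤n n≤n′ , y≈±1

  Certificate : ℕ → Set
  Certificate n₀ = 1 ≤ n₀ × Solution N (replicate n₀ c) × ¬ BlockWithin n₀

  certificate? : ∀ n₀ → Dec (Certificate n₀)
  certificate? n₀ = (1 ℕ.≤? n₀) ×-dec solution? (replicate n₀ c) ×-dec ¬? (blockWithin? n₀)

  certificate⇒¬blockWithin : ∀ {n₀ n} → Certificate n₀ → IsMonomialMinimalSize N c n → ¬ BlockWithin n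
  certificate⇒¬blockWithin (1≤n₀ , sol , ¬block) (_ , _ , shortest) =
    ¬block ∘ blockWithin-mono (ℕ.≮⇒≥ λ n₀<n → shortest _ 1≤n₀ n₀<n sol)

module _ (N : ℕ) .{{_ : NonZero N}} where
  open Lifting N
  open Monomial N using (BlockWithin; irreducible⇔¬blockWithin; prime⇒¬blockWithin;
                         Certificate; certificate?; certificate⇒¬blockWithin; replicate-solution⇔)

  monomiallyIrreducible⇔ : 2 ≤ N →
    MonomiallyIrreducible N ⇔ (∀ c → c ≢ zeroN N → ∀ {n} → IsMonomialMinimalSize N c n → ¬ BlockWithin c n)
  monomiallyIrreducible⇔ 2≤N = mk⇔
    (λ irreducible c c≢0 {n} minimal → to (irreducible⇔¬blockWithin c 2≤N c≢0 minimal) (irreducible c c≢0 n minimal))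
    (λ ¬block c c≢0 n minimal → from (irreducible⇔¬blockWithin c 2≤N c≢0 minimal) (¬block c c≢0 minimal))
    where open Equivalence

  prime⇒monomiallyIrreducible : 2 ≤ N → Prime N → MonomiallyIrreducible N
  prime⇒monomiallyIrreducible 2≤N N-prime =
    Equivalence.from (monomiallyIrreducible⇔ 2≤N) λ c _ → prime⇒¬blockWithin c N-prime

  Certified : Set
  Certified = ∀ c → c ≡ zeroN N ⊎ ∃[ n₀ ] n₀ < suc N × Certificate c n₀

  certified? : Dec Certified
  certified? = all? λ c → (c ≟ zeroN N) ⊎-dec any<? (certificate? c) (suc N)

  certified⇒monomiallyIrreducible : 2 ≤ N → Certified → MonomiallyIrreducible N
  certified⇒monomiallyIrreducible 2≤N certified = Equivalence.from (monomiallyIrreducible⇔ 2≤N) λ c c≢0 →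
    [ ⊥-elim ∘ c≢0 , (λ (_ , _ , certificate) → certificate⇒¬blockWithin c certificate) ]′ (certified c)

  solution⇒minimalSize : ∀ c {n₁} → 1 ≤ n₁ → Solution N (replicate n₁ c) → ∃[ n ] IsMonomialMinimalSize N c n
  solution⇒minimalSize c = leastPositive (λ n → solution? (replicate n c))

  module _ (2≤N : 2 ≤ N) where
    open ChebyshevModulo N using (s-cong)
    open Chebyshev using () renaming (s to sᵏ)

    ¬monomiallyIrreducible : ∀ k → ¬ (k ≈ 0ℤ) →
      ∀ {n₁} → 1 ≤ n₁ → sᵏ k n₁ ≈ 0ℤ → sᵏ k (suc n₁) ≈±1 →
      ∀ {L} → 1 ≤ L → sᵏ k (suc L) ≈±1 → (∀ m → 1 ≤ m → m < L ℕ.+ 3 → ¬ sᵏ k m ≈ 0ℤ) →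
      ¬ MonomiallyIrreducible N
    ¬monomiallyIrreducible k k≉0 {n₁} 1≤n₁ zero₁ unit₁ {L} 1≤L unitL no-early-zero irreducible =
      Equivalence.to (monomiallyIrreducible⇔ 2≤N) irreducible c c≢0 minimal
        (L , 1≤L , ℕ.≮⇒≥ (λ n<L+3 → no-early-zero n 1≤n n<L+3 zeroₙ) , ≈±1-respˡ (s-cong c≈k (suc L)) unitL)
      where
      c : Fin N
      c = fromℤ k
      c≈k : toℤ c ≈ k
      c≈k = toℤ-fromℤ k
      c≢0 : c ≢ zeroN N
      c≢0 c≡0 = k≉0 (≈-trans (≈-sym c≈k) (≈-trans (≡⇒≈ (cong toℤ c≡0)) toℤ-zeroN))
      sol₁ : Solution N (replicate n₁ c)
      sol₁ = Equivalence.from (replicate-solution⇔ c n₁)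
        (≈-trans (s-cong c≈k n₁) zero₁ , ≈±1-respˡ (s-cong c≈k (suc n₁)) unit₁)
      n : ℕ
      n = proj₁ (solution⇒minimalSize c 1≤n₁ sol₁)
      minimal : IsMonomialMinimalSize N c n
      minimal = proj₂ (solution⇒minimalSize c 1≤n₁ sol₁)
      1≤n : 1 ≤ n
      1≤n = proj₁ minimal
      zeroₙ : sᵏ k n ≈ 0ℤ
      zeroₙ = ≈-trans (≈-sym (s-cong c≈k n))
                      (proj₁ (Equivalence.to (replicate-solution⇔ c n) (proj₁ (proj₂ minimal))))

-- Moduli that are not monomially irreducible

module SquareFactor (N : ℕ) .{{_ : NonZero N}} (2≤N : 2 ≤ N) (d e : ℕ) (3≤d : 3 ≤ d) (1≤e : 1 ≤ e)
                    (N≡d²e : N ≡ d ℕ.* d ℕ.* e) where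
  open Residues N
  open ChebyshevModulo N
  open Chebyshev using (s)

  k : ℤ
  k = + (d ℕ.* e)

  N≡d*de : N ≡ d ℕ.* (d ℕ.* e)
  N≡d*de = trans N≡d²e (ℕ.*-assoc d d e)

  0<d : 0 < d
  0<d = ℕ.<-trans (s≤s z≤n) (ℕ.<-trans (s≤s (s≤s z≤n)) 3≤d)

  0<de : 0 < d ℕ.* e
  0<de = ℕ.*-mono-≤ 0<d 1≤e

  de<N : d ℕ.* e < N
  de<N = subst₂ _<_ (ℕ.*-identityˡ (d ℕ.* e)) (sym N≡d*de)
           (ℕ.*-monoˡ-< (d ℕ.* e) {{ℕ.>-nonZero 0<de}} (ℕ.<-trans (s≤s (s≤s z≤n)) 3≤d))

  2de<N : 2 ℕ.* (d ℕ.* e) < N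
  2de<N = subst (2 ℕ.* (d ℕ.* e) <_) (sym N≡d*de) (ℕ.*-monoˡ-< (d ℕ.* e) {{ℕ.>-nonZero 0<de}} 3≤d)

  k≉0 : ¬ (k ≈ 0ℤ)
  k≉0 = positive<N⇒≉0 0<de de<N

  k²≈0 : k * k ≈ 0ℤ
  k²≈0 = ≈-trans (≡⇒≈ (begin
    + (d ℕ.* e) * + (d ℕ.* e)    ≡⟨ ℤ.pos-* (d ℕ.* e) (d ℕ.* e) ⟨
    + (d ℕ.* e ℕ.* (d ℕ.* e))    ≡⟨ cong +_ (rearrange d e) ⟩
    + (e ℕ.* (d ℕ.* (d ℕ.* e)))  ≡⟨ cong (λ n → + (e ℕ.* n)) N≡d*de ⟨
    + (e ℕ.* N)                  ≡⟨ ℤ.pos-* e N ⟩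
    + e * + N                    ∎)) (*N≈0 (+ e))
    where
    open ≡-Reasoning
    rearrange : ∀ d e → d ℕ.* e ℕ.* (d ℕ.* e) ≡ e ℕ.* (d ℕ.* (d ℕ.* e))
    rearrange = ℕ-Solver.solve-∀

  values : ∀ i → s k (i ℕ.+ i) ≈ - ((- 1ℤ) ^ i * (+ i * k)) × s k (suc (i ℕ.+ i)) ≈ (- 1ℤ) ^ i
  values = s-nilpotent {k} k²≈0

  dk≈0 : + d * k ≈ 0ℤ
  dk≈0 = ≈-trans (≡⇒≈ (trans (sym (ℤ.pos-* d (d ℕ.* e))) (cong +_ (sym N≡d*de)))) N≈0

  zero-at-2d : s k (d ℕ.+ d) ≈ 0ℤ
  zero-at-2d = begin
    s k (d ℕ.+ d)                  ≈⟨ proj₁ (values d) ⟩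
    - ((- 1ℤ) ^ d * (+ d * k))     ≈⟨ -‿cong (*-cong (≈-refl {x = (- 1ℤ) ^ d}) dk≈0) ⟩
    - ((- 1ℤ) ^ d * 0ℤ)            ≡⟨ cong -_ (ℤ.*-zeroʳ ((- 1ℤ) ^ d)) ⟩
    0ℤ                             ∎
    where open ≈-Reasoning

  no-early-zero : ∀ m → 1 ≤ m → m < 5 → ¬ (s k m ≈ 0ℤ)
  no-early-zero 1 _ _ = 1≉0 2≤N
  no-early-zero 2 _ _ = k≉0 ∘ ≈-trans (≡⇒≈ (s₂ k))
    where s₂ : ∀ k → k ≡ k * 1ℤ - 0ℤ
          s₂ = solve-∀
  no-early-zero 3 _ _ = ≈±1⇒≉0 2≤N (≈±1-respˡ (proj₂ (values 1)) (sign-≈±1 1))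
  no-early-zero 4 _ _ s₄≈0 = positive<N⇒≉0 (ℕ.≤-trans (s≤s z≤n) (ℕ.*-monoʳ-≤ 2 0<de)) 2de<N (begin
    + (2 ℕ.* (d ℕ.* e))           ≡⟨ ℤ.pos-* 2 (d ℕ.* e) ⟩
    + 2 * k                       ≡⟨ s₄ k ⟩
    - - ((- 1ℤ) ^ 2 * (+ 2 * k))  ≈⟨ -‿cong (≈-trans (≈-sym (proj₁ (values 2))) s₄≈0) ⟩
    - 0ℤ                          ≡⟨⟩
    0ℤ                            ∎)
    where
    open ≈-Reasoning
    s₄ : ∀ k → + 2 * k ≡ - - ((- 1ℤ) ^ 2 * (+ 2 * k))
    s₄ = solve-∀
  no-early-zero (suc (suc (suc (suc (suc _))))) _ (s≤s (s≤s (s≤s (s≤s (s≤s ())))))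

  ¬irreducible : ¬ MonomiallyIrreducible N
  ¬irreducible = ¬monomiallyIrreducible N 2≤N k k≉0
    {n₁ = d ℕ.+ d} (ℕ.≤-trans (ℕ.≤-trans (s≤s z≤n) 3≤d) (ℕ.m≤m+n d d)) zero-at-2d (≈±1-respˡ (proj₂ (values d)) (sign-≈±1 d))
    {L = 2} (s≤s z≤n) (≈±1-respˡ (proj₂ (values 1)) (sign-≈±1 1)) no-early-zero

squareFactor⇒¬monomiallyIrreducible : ∀ N .{{_ : NonZero N}} → 2 ≤ N →
  ∀ d e → 3 ≤ d → 1 ≤ e → N ≡ d ℕ.* d ℕ.* e → ¬ MonomiallyIrreducible N
squareFactor⇒¬monomiallyIrreducible N 2≤N d e 3≤d 1≤e N≡d²e = SquareFactor.¬irreducible N 2≤N d e 3≤d 1≤e N≡d²e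

module CoprimeFactor (p B : ℕ) (p-prime : Prime p) (5≤p : 5 ≤ p) (p∤B : ¬ (p ∣ℕ B)) (2≤B : 2 ≤ B) where
  private
    module ModP = Modulo p
    module ModB = Modulo B
    open ModP using () renaming (_≈_ to _≈ₚ_)
    open ModB using () renaming (_≈_ to _≈ᴮ_; _≈±1 to _≈ᴮ±1)
    open Modulo (p ℕ.* B)
    open Chebyshev using (s)

  B⊥p : Coprime B p
  B⊥p (d∣B , d∣p) with prime⇒irreducible p-prime d∣p
  ... | inj₁ d≡1  = d≡1
  ... | inj₂ refl = ⊥-elim (p∤B d∣B)

  restrictₚ : ∀ {x y} → x ≈ y → x ≈ₚ y
  restrictₚ = ≈ₘₙ⇒≈ₘ {p} {B}

  restrictᴮ : ∀ {x y} → x ≈ y → x ≈ᴮ y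
  restrictᴮ = ≈ₘₙ⇒≈ₙ {p} {B}

  crt : ∀ {x y} → x ≈ₚ y → x ≈ᴮ y → x ≈ y
  crt = chineseRemainder {p} {B} (Coprimality.sym B⊥p)

  k : ℤ
  k = 1ℤ + + B * proj₁ (ModP.coprime⇒invertible B⊥p)

  k≈ₚ2 : k ≈ₚ + 2
  k≈ₚ2 = ModP.+-cong (ModP.≈-refl {x = 1ℤ}) (proj₂ (ModP.coprime⇒invertible B⊥p))

  k≈ᴮ1 : k ≈ᴮ 1ℤ
  k≈ᴮ1 = ModB.congruent t (cong (_+_ 1ℤ) (ℤ.*-comm (+ B) t))
    where t = proj₁ (ModP.coprime⇒invertible B⊥p)

  sₚ : ∀ j → s k j ≈ₚ + j
  sₚ = ChebyshevModulo.s-at-2 p k≈ₚ2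

  sᴮ : ∀ q r → s k (q ℕ.* 6 ℕ.+ r) ≈ᴮ s k r
  sᴮ = ChebyshevModulo.s-at-1-periodic B k≈ᴮ1

  s₂≈ᴮ1 : s k 2 ≈ᴮ 1ℤ
  s₂≈ᴮ1 = ModB.+-cong (ModB.*-cong k≈ᴮ1 ModB.≈-refl) ModB.≈-refl

  s₄≈ᴮ-1 : s k 4 ≈ᴮ - 1ℤ
  s₄≈ᴮ-1 = ChebyshevModulo.s-at-1-antiperiodic B k≈ᴮ1 1

  s₅≈ᴮ-1 : s k 5 ≈ᴮ - 1ℤ
  s₅≈ᴮ-1 = ModB.≈-trans (ChebyshevModulo.s-at-1-antiperiodic B k≈ᴮ1 2) (ModB.-‿cong s₂≈ᴮ1)

  p-mod-6 : ∃[ q ] (p ≡ q ℕ.* 6 ℕ.+ 1 ⊎ p ≡ q ℕ.* 6 ℕ.+ 5)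
  p-mod-6 = p / 6 , classify (p % 6) (m%n<n p 6) (trans (m≡m%n+[m/n]*n p 6) (ℕ.+-comm (p % 6) _))
    where
    q = p / 6
    ¬small∣p : ∀ d → 2 ≤ d → d < 5 → ¬ (d ∣ℕ p)
    ¬small∣p d 2≤d d<5 d∣p with prime⇒irreducible p-prime d∣p
    ... | inj₁ refl = ℕ.<⇒≱ 2≤d ℕ.≤-refl
    ... | inj₂ refl = ℕ.<⇒≱ d<5 5≤p
    classify : ∀ r → r < 6 → p ≡ q ℕ.* 6 ℕ.+ r → p ≡ q ℕ.* 6 ℕ.+ 1 ⊎ p ≡ q ℕ.* 6 ℕ.+ 5
    classify 0 _ p≡ = ⊥-elim (¬small∣p 2 ℕ.≤-refl (s≤s (s≤s (s≤s z≤n))) (divides (q ℕ.* 3) (trans p≡ (even₀ q))))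
      where even₀ : ∀ q → q ℕ.* 6 ℕ.+ 0 ≡ q ℕ.* 3 ℕ.* 2
            even₀ = ℕ-Solver.solve-∀
    classify 1 _ p≡ = inj₁ p≡
    classify 2 _ p≡ = ⊥-elim (¬small∣p 2 ℕ.≤-refl (s≤s (s≤s (s≤s z≤n))) (divides (q ℕ.* 3 ℕ.+ 1) (trans p≡ (even₂ q))))
      where even₂ : ∀ q → q ℕ.* 6 ℕ.+ 2 ≡ (q ℕ.* 3 ℕ.+ 1) ℕ.* 2
            even₂ = ℕ-Solver.solve-∀
    classify 3 _ p≡ = ⊥-elim (¬small∣p 3 (s≤s (s≤s z≤n)) (s≤s (s≤s (s≤s (s≤s z≤n))))
                                (divides (q ℕ.* 2 ℕ.+ 1) (trans p≡ (triple q))))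
      where triple : ∀ q → q ℕ.* 6 ℕ.+ 3 ≡ (q ℕ.* 2 ℕ.+ 1) ℕ.* 3
            triple = ℕ-Solver.solve-∀
    classify 4 _ p≡ = ⊥-elim (¬small∣p 2 ℕ.≤-refl (s≤s (s≤s (s≤s z≤n))) (divides (q ℕ.* 3 ℕ.+ 2) (trans p≡ (even₄ q))))
      where even₄ : ∀ q → q ℕ.* 6 ℕ.+ 4 ≡ (q ℕ.* 3 ℕ.+ 2) ℕ.* 2
            even₄ = ℕ-Solver.solve-∀
    classify 5 _ p≡ = inj₂ p≡
    classify (suc (suc (suc (suc (suc (suc _)))))) (s≤s (s≤s (s≤s (s≤s (s≤s (s≤s ())))))) _

  zeroₚ⇒≡p : ∀ {m} → 1 ≤ m → m < p ℕ.+ 3 → + m ≈ₚ 0ℤ → m ≡ p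
  zeroₚ⇒≡p 1≤m m<p+3 m≈0 with ModP.≈0⇒∣∣ m≈0
  ... | divides zero refl = ⊥-elim (ℕ.<⇒≱ 1≤m z≤n)
  ... | divides (suc zero) refl = ℕ.+-identityʳ p
  ... | divides (suc (suc c)) refl =
    ⊥-elim (ℕ.<⇒≱ m<p+3 (ℕ.+-monoʳ-≤ p (ℕ.≤-trans (ℕ.≤-trans (s≤s (s≤s (s≤s z≤n))) 5≤p) (ℕ.m≤m+n p (c ℕ.* p)))))

  no-early-zero : s k p ≈ᴮ±1 → ∀ m → 1 ≤ m → m < p ℕ.+ 3 → ¬ (s k m ≈ 0ℤ)
  no-early-zero sₚ≈±1 m 1≤m m<p+3 sₘ≈0
    with zeroₚ⇒≡p 1≤m m<p+3 (ModP.≈-trans (ModP.≈-sym (sₚ m)) (restrictₚ sₘ≈0))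
  ... | refl = ModB.≈±1⇒≉0 2≤B sₚ≈±1 (restrictᴮ sₘ≈0)

  k≉0 : ¬ (k ≈ 0ℤ)
  k≉0 k≈0 = ModP.positive<N⇒≉0 (s≤s z≤n) (ℕ.≤-trans (s≤s (s≤s (s≤s z≤n))) 5≤p)
              (ModP.≈-trans (ModP.≈-sym k≈ₚ2) (restrictₚ k≈0))


  zero-at-6p : s k (p ℕ.* 6) ≈ 0ℤ
  zero-at-6p = crt
    (ModP.≈-trans (sₚ (p ℕ.* 6)) (ModP.∣∣⇒≈0 (divides 6 (ℕ.*-comm p 6))))
    (subst (λ j → s k j ≈ᴮ 0ℤ) (ℕ.+-identityʳ (p ℕ.* 6)) (sᴮ p 0))

  unit-after-6p : s k (suc (p ℕ.* 6)) ≈ 1ℤ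
  unit-after-6p = crt
    (ModP.≈-trans (sₚ (suc (p ℕ.* 6)))
                  (ModP.+-cong (ModP.≈-refl {x = 1ℤ}) (ModP.∣∣⇒≈0 {x = + (p ℕ.* 6)} (divides 6 (ℕ.*-comm p 6)))))
    (subst (λ j → s k j ≈ᴮ 1ℤ) (ℕ.+-comm (p ℕ.* 6) 1) (sᴮ p 1))

  1≤p : 1 ≤ p
  1≤p = ℕ.≤-trans (s≤s z≤n) 5≤p

  1≤6p : 1 ≤ p ℕ.* 6
  1≤6p = ℕ.*-mono-≤ 1≤p (s≤s z≤n)

  ¬irreducible : .{{_ : NonZero (p ℕ.* B)}} → 2 ≤ p ℕ.* B → ¬ MonomiallyIrreducible (p ℕ.* B)
  ¬irreducible 2≤N with p-mod-6
  ... | q , inj₁ p≡6q+1 =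
    ¬monomiallyIrreducible (p ℕ.* B) 2≤N k k≉0 1≤6p zero-at-6p (inj₁ unit-after-6p)
      {L = p} 1≤p (inj₁ unit-after-p) (no-early-zero (inj₁ (subst (λ j → s k j ≈ᴮ 1ℤ) (sym p≡6q+1) (sᴮ q 1))))
    where
    unit-after-p : s k (suc p) ≈ 1ℤ
    unit-after-p = crt
      (ModP.≈-trans (sₚ (suc p)) (ModP.+-cong (ModP.≈-refl {x = 1ℤ}) ModP.N≈0))
      (subst (λ j → s k j ≈ᴮ 1ℤ) (sym (trans (cong suc p≡6q+1) (sym (ℕ.+-suc (q ℕ.* 6) 1))))
             (ModB.≈-trans (sᴮ q 2) s₂≈ᴮ1))
  ... | q , inj₂ p≡6q+5 =
    ¬monomiallyIrreducible (p ℕ.* B) 2≤N k k≉0 1≤6p zero-at-6p (inj₁ unit-after-6p)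
      {L = L} (ℕ.≤-trans (s≤s z≤n) (ℕ.m≤n+m 3 (q ℕ.* 6))) (inj₂ unit-after-L)
      (λ m 1≤m m<L+3 → no-early-zero (inj₂ sₚ≈ᴮ-1) m 1≤m (ℕ.<-≤-trans m<L+3 (ℕ.+-monoˡ-≤ 3 L≤p)))
    where
    L = q ℕ.* 6 ℕ.+ 3
    L≤p : L ≤ p
    L≤p = subst (L ≤_) (sym p≡6q+5) (ℕ.+-monoʳ-≤ (q ℕ.* 6) (s≤s (s≤s (s≤s z≤n))))
    2+L≡p : suc (suc L) ≡ p
    2+L≡p = trans (sym (trans (ℕ.+-suc (q ℕ.* 6) 4) (cong suc (ℕ.+-suc (q ℕ.* 6) 3)))) (sym p≡6q+5)
    sₚ≈ᴮ-1 : s k p ≈ᴮ - 1ℤ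
    sₚ≈ᴮ-1 = subst (λ j → s k j ≈ᴮ - 1ℤ) (sym p≡6q+5) (ModB.≈-trans (sᴮ q 5) s₅≈ᴮ-1)
    predecessor : ∀ x → x ≡ (1ℤ + x) - 1ℤ
    predecessor = solve-∀
    unit-after-L : s k (suc L) ≈ - 1ℤ
    unit-after-L = crt
      (ModP.≈-trans (sₚ (suc L)) (ModP.≈-trans
        (ModP.≡⇒≈ (trans (predecessor (+ suc L)) (cong (λ j → + j - 1ℤ) 2+L≡p)))
        (ModP.+-cong ModP.N≈0 (ModP.≈-refl {x = - 1ℤ}))))
      (subst (λ j → s k j ≈ᴮ - 1ℤ) (ℕ.+-suc (q ℕ.* 6) 3) (ModB.≈-trans (sᴮ q 4) s₄≈ᴮ-1))

coprimeFactor⇒¬monomiallyIrreducible : ∀ N .{{_ : NonZero N}} → 2 ≤ N →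
  ∀ p B → Prime p → 5 ≤ p → ¬ (p ∣ℕ B) → 2 ≤ B → N ≡ p ℕ.* B → ¬ MonomiallyIrreducible N
coprimeFactor⇒¬monomiallyIrreducible _ 2≤N p B p-prime 5≤p p∤B 2≤B refl =
  CoprimeFactor.¬irreducible p B p-prime 5≤p p∤B 2≤B 2≤N

-- Classification

Exceptional : ℕ → Set
Exceptional N = N ≡ 4 ⊎ N ≡ 6 ⊎ N ≡ 8 ⊎ N ≡ 12 ⊎ N ≡ 24

exceptional⇒monomiallyIrreducible : ∀ N .{{_ : NonZero N}} → Exceptional N → MonomiallyIrreducible N
exceptional⇒monomiallyIrreducible _ (inj₁ refl) =
  certified⇒monomiallyIrreducible 4 (s≤s (s≤s z≤n)) (from-yes (certified? 4))
exceptional⇒monomiallyIrreducible _ (inj₂ (inj₁ refl)) =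
  certified⇒monomiallyIrreducible 6 (s≤s (s≤s z≤n)) (from-yes (certified? 6))
exceptional⇒monomiallyIrreducible _ (inj₂ (inj₂ (inj₁ refl))) =
  certified⇒monomiallyIrreducible 8 (s≤s (s≤s z≤n)) (from-yes (certified? 8))
exceptional⇒monomiallyIrreducible _ (inj₂ (inj₂ (inj₂ (inj₁ refl)))) =
  certified⇒monomiallyIrreducible 12 (s≤s (s≤s z≤n)) (from-yes (certified? 12))
exceptional⇒monomiallyIrreducible _ (inj₂ (inj₂ (inj₂ (inj₂ refl)))) =
  certified⇒monomiallyIrreducible 24 (s≤s (s≤s z≤n)) (from-yes (certified? 24))

data FactorShape (n : ℕ) : Set where
  largePrime  : ∀ p → Prime p → 5 ≤ p → p ∣ℕ n → FactorShape n
  sixteen∣    : 16 ∣ℕ n → FactorShape n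
  nine∣       : 9 ∣ℕ n → FactorShape n
  ∣twentyFour : n ∣ℕ 24 → FactorShape n

private
  SmallShape : ℕ → Set
  SmallShape m = 16 ∣ℕ m ⊎ 9 ∣ℕ m ⊎ m ∣ℕ 24

  small-prime : ∀ f → f < 5 → Prime f → f ≡ 2 ⊎ f ≡ 3
  small-prime = from-yes (all<? (λ f → prime? f →-dec ((f ℕ.≟ 2) ⊎-dec (f ℕ.≟ 3))) 5)

  small-multiples : ∀ m → m < 25 → m ∣ℕ 24 → SmallShape (2 ℕ.* m) × SmallShape (3 ℕ.* m)
  small-multiples = from-yes (all<? (λ m → (m ∣? 24) →-dec (smallShape? (2 ℕ.* m) ×-dec smallShape? (3 ℕ.* m))) 25)
    where
    smallShape? : ∀ m → Dec (SmallShape m)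
    smallShape? m = (16 ∣? m) ⊎-dec (9 ∣? m) ⊎-dec (m ∣? 24)

  divisor-of-24 : ∀ N → N < 25 → N ∣ℕ 24 → 2 ≤ N → Prime N ⊎ Exceptional N
  divisor-of-24 = from-yes (all<? (λ N → (N ∣? 24) →-dec (2 ℕ.≤? N) →-dec (prime? N ⊎-dec exceptional? N)) 25)
    where
    exceptional? : ∀ N → Dec (Exceptional N)
    exceptional? N = (N ℕ.≟ 4) ⊎-dec (N ℕ.≟ 6) ⊎-dec (N ℕ.≟ 8) ⊎-dec (N ℕ.≟ 12) ⊎-dec (N ℕ.≟ 24)

  fromSmallShape : ∀ {m} → SmallShape m → FactorShape m
  fromSmallShape = [ sixteen∣ , [ nine∣ , ∣twentyFour ]′ ]′

  shape-* : ∀ f → Prime f → ∀ {m} → FactorShape m → FactorShape (f ℕ.* m)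
  shape-* f f-prime (largePrime p p-prime 5≤p p∣m) = largePrime p p-prime 5≤p (∣-trans p∣m (n∣m*n f))
  shape-* f f-prime (sixteen∣ 16∣m) = sixteen∣ (∣-trans 16∣m (n∣m*n f))
  shape-* f f-prime (nine∣ 9∣m) = nine∣ (∣-trans 9∣m (n∣m*n f))
  shape-* f f-prime {m} (∣twentyFour m∣24) with 5 ℕ.≤? f
  ... | yes 5≤f = largePrime f f-prime 5≤f (m∣m*n m)
  ... | no f≱5 = small-* (small-prime f (ℕ.≰⇒> f≱5) f-prime) (small-multiples m (s≤s (∣⇒≤ m∣24)) m∣24)
    where
    small-* : f ≡ 2 ⊎ f ≡ 3 → SmallShape (2 ℕ.* m) × SmallShape (3 ℕ.* m) → FactorShape (f ℕ.* m)
    small-* (inj₁ refl) shapes = fromSmallShape (proj₁ shapes)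
    small-* (inj₂ refl) shapes = fromSmallShape (proj₂ shapes)

  shape-product : ∀ fs → All Prime fs → FactorShape (product fs)
  shape-product []       []                   = ∣twentyFour (divides 24 refl)
  shape-product (f ∷ fs) (f-prime ∷ fs-prime) = shape-* f f-prime (shape-product fs fs-prime)

factorShape : ∀ n .{{_ : NonZero n}} → FactorShape n
factorShape n = subst FactorShape (sym (PrimeFactorisation.isFactorisation fn))
  (shape-product (factors fn) (PrimeFactorisation.factorsPrime fn))
  where
  fn : PrimeFactorisation n
  fn = factorise n

private
  cofactor-positive : ∀ {N} e m → 2 ≤ N → N ≡ e ℕ.* m → 1 ≤ e
  cofactor-positive zero    m 2≤N refl = ⊥-elim (ℕ.<⇒≱ 2≤N z≤n)
  cofactor-positive (suc e) m _   _    = s≤s z≤n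

  square-form : ∀ e d → e ℕ.* (d ℕ.* d) ≡ d ℕ.* d ℕ.* e
  square-form = ℕ-Solver.solve-∀

monomiallyIrreducible⇒prime⊎exceptional : ∀ N .{{_ : NonZero N}} → 2 ≤ N →
  MonomiallyIrreducible N → Prime N ⊎ Exceptional N
monomiallyIrreducible⇒prime⊎exceptional N 2≤N irreducible with factorShape N
... | largePrime p p-prime 5≤p (divides B N≡Bp) with p ∣? B
...   | yes (divides e B≡ep) = ⊥-elim (squareFactor⇒¬monomiallyIrreducible N 2≤N p e 3≤p
          (cofactor-positive e (p ℕ.* p) 2≤N N≡e*p²) (trans N≡e*p² (square-form e p)) irreducible)
  where
  3≤p : 3 ≤ p
  3≤p = ℕ.≤-trans (s≤s (s≤s (s≤s z≤n))) 5≤p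
  N≡e*p² : N ≡ e ℕ.* (p ℕ.* p)
  N≡e*p² = trans N≡Bp (trans (cong (ℕ._* p) B≡ep) (ℕ.*-assoc e p p))
...   | no p∤B = large-prime-cofactor B p∤B N≡Bp
  where
  large-prime-cofactor : ∀ B → ¬ (p ∣ℕ B) → N ≡ B ℕ.* p → Prime N ⊎ Exceptional N
  large-prime-cofactor 0 _ N≡0 = ⊥-elim (ℕ.<⇒≱ 2≤N (ℕ.≤-trans (ℕ.≤-reflexive N≡0) z≤n))
  large-prime-cofactor 1 _ N≡p = inj₁ (subst Prime (sym (trans N≡p (ℕ.+-identityʳ p))) p-prime)
  large-prime-cofactor B@(suc (suc _)) p∤B N≡Bp = ⊥-elim (coprimeFactor⇒¬monomiallyIrreducible N 2≤N p B p-prime 5≤p p∤B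
    (s≤s (s≤s z≤n)) (trans N≡Bp (ℕ.*-comm B p)) irreducible)
monomiallyIrreducible⇒prime⊎exceptional N 2≤N irreducible | sixteen∣ (divides e N≡e*16) =
  ⊥-elim (squareFactor⇒¬monomiallyIrreducible N 2≤N 4 e (s≤s (s≤s (s≤s z≤n)))
    (cofactor-positive e 16 2≤N N≡e*16) (trans N≡e*16 (square-form e 4)) irreducible)
monomiallyIrreducible⇒prime⊎exceptional N 2≤N irreducible | nine∣ (divides e N≡e*9) =
  ⊥-elim (squareFactor⇒¬monomiallyIrreducible N 2≤N 3 e (s≤s (s≤s (s≤s z≤n)))
    (cofactor-positive e 9 2≤N N≡e*9) (trans N≡e*9 (square-form e 3)) irreducible)
monomiallyIrreducible⇒prime⊎exceptional N 2≤N irreducible | ∣twentyFour N∣24 =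
  divisor-of-24 N (s≤s (∣⇒≤ N∣24)) N∣24 2≤N

mainTheorem1 : (N : ℕ) .{{_ : NonZero N}} → 2 ≤ N →
    (MonomiallyIrreducible N ⇔ (Prime N ⊎ (N ≡ 4 ⊎ N ≡ 6 ⊎ N ≡ 8 ⊎ N ≡ 12 ⊎ N ≡ 24)))
mainTheorem1 N 2≤N = mk⇔
  (monomiallyIrreducible⇒prime⊎exceptional N 2≤N)
  [ prime⇒monomiallyIrreducible N 2≤N , exceptional⇒monomiallyIrreducible N ]′
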